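{- (a) The left peak number $\mathrm{lpk}$ is shuffle-compatible. (b) The linear map on $\mathcal{A}_{\mathrm{lpk}}$ defined by $[\pi]_{\mathrm{lpk}}\mapsto\frac{2^{2\mathrm{lpk}(\pi)}t^{\mathrm{lpk}(\pi)}(1+t)^{|\pi|-2\mathrm{lpk}(\pi)}}{(1-t)^{|\pi|+1}}x^{|\pi|}$ if $|\pi|\ge1$ and $[\pi]_{\mathrm{lpk}}\mapsto1/(1-t)$ if $|\pi|=0$ is a $\mathbb{Q}$-algebra isomorphism from $\mathcal{A}_{\mathrm{lpk}}$ to the span of $\{\frac1{1-t}\}\cup\{\frac{2^{2j}t^j(1+t)^{n-2j}}{(1-t)^{n+1}}x^n\}_{n\ge1,\,0\le j\le\lfloor n/2\rfloor}$, a subalgebra of $\mathbb{Q}[[t*]][x]$. (c) The $n$th homogeneous component of $\mathcal{A}_{\mathrm{lpk}}$ has dimension $\lfloor n/2\rfloor+1$.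
   Context: A permutation of length $n$ is a sequence $\pi=\pi_1\cdots\pi_n$ of distinct positive integers. A peak is an index $2\le i\le n-1$ with $\pi_{i-1}<\pi_i>\pi_{i+1}$; a left peak is an $i\in[n-1]$ that is a peak or is $i=1$ with $\pi_1>\pi_2$; $\mathrm{lpk}(\pi)$ is the number of left peaks. For disjoint permutations, $S(\pi,\sigma)$ is the set of shuffles (permutations of length $|\pi|+|\sigma|$ containing both as subsequences). A statistic $\mathrm{st}$ is shuffle-compatible if for disjoint $\pi,\sigma$ the multiset $\{\mathrm{st}(\tau):\tau\in S(\pi,\sigma)\}$ depends only on $\mathrm{st}(\pi),\mathrm{st}(\sigma),|\pi|,|\sigma|$; its shuffle algebra $\mathcal{A}_{\mathrm{st}}$ has basis the classes $[\pi]_{\mathrm{st}}$ of permutations with equal length and $\mathrm{st}$-value, product $[\pi]_{\mathrm{st}}[\sigma]_{\mathrm{st}}=\sum_{\tau\in S(\pi,\sigma)}[\tau]_{\mathrm{st}}$, graded by length. $\mathbb{Q}[[t*]][x]$ denotes polynomials in $x$ with coefficients formal power series in $t$, with multiplication ordinary in $x$ and the Hadamard product $(\sum a_nt^n)*(\sum b_nt^n)=\sum a_nb_nt^n$ in $t$. -}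

module Defs where

open import Data.Nat as ℕ using (ℕ; zero; suc; _∸_; _<ᵇ_; _≡ᵇ_; _≤ᵇ_)
open import Data.Bool using (Bool; true; false; if_then_else_; _∧_)
open import Data.List using (List; []; _∷_; [_]; map; _++_; foldr; length; upTo)
open import Data.List.Relation.Unary.All using (All)
open import Data.List.Relation.Unary.Unique.Propositional using (Unique)
open import Data.List.Membership.Propositional using (_∈_; _∉_)
open import Data.Integer using (+_)
open import Data.Rational using (ℚ; 0ℚ; 1ℚ; _/_)
import Data.Rational as Q
open import Data.Product using (_×_; Σ)
open import Data.Sum using (_⊎_)
open import Relation.Binary.PropositionalEquality using (_≡_; _≢_)

IsPerm : List ℕ → Set
IsPerm π = Unique π × All (λ a → 1 ℕ.≤ a) π

Disjoint : List ℕ → List ℕ → Set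
Disjoint π σ = ∀ {a} → a ∈ π → a ∉ σ

peaks : List ℕ → ℕ
peaks (a ∷ b ∷ c ∷ rest) =
  (if (a <ᵇ b) ∧ (c <ᵇ b) then 1 else 0) ℕ.+ peaks (b ∷ c ∷ rest)
peaks _ = 0

lpk : List ℕ → ℕ
lpk (a ∷ b ∷ rest) = (if b <ᵇ a then 1 else 0) ℕ.+ peaks (a ∷ b ∷ rest)
lpk _ = 0

-- the shuffles of π and σ (all interleavings), listed with multiplicity
shuffles : List ℕ → List ℕ → List (List ℕ)
shuffles [] ys = [ ys ]
shuffles (x ∷ xs) [] = [ x ∷ xs ]
shuffles (x ∷ xs) (y ∷ ys) =
  map (x ∷_) (shuffles xs (y ∷ ys)) ++ map (y ∷_) (shuffles (x ∷ xs) ys)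

ℕtoℚ : ℕ → ℚ
ℕtoℚ n = (+ n) / 1

sumℚ : List ℚ → ℚ
sumℚ = foldr Q._+_ 0ℚ

Series : Set
Series = ℕ → ℚ   -- coefficient of t^m

_·ₛ_ : Series → Series → Series
(f ·ₛ g) m = sumℚ (map (λ i → f i Q.* g (m ∸ i)) (upTo (suc m)))

_*ₕ_ : Series → Series → Series
(f *ₕ g) m = f m Q.* g m

_+ₛ_ : Series → Series → Series
(f +ₛ g) m = f m Q.+ g m

scaleₛ : ℚ → Series → Series
scaleₛ c f m = c Q.* f m

oneₛ : Series
oneₛ m = if m ≡ᵇ 0 then 1ℚ else 0ℚ

_^ₛ_ : Series → ℕ → Series
f ^ₛ zero = oneₛ
f ^ₛ suc k = f ·ₛ (f ^ₛ k)

tₛ : Series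
tₛ m = if m ≡ᵇ 1 then 1ℚ else 0ℚ

onePlusT : Series
onePlusT m = if m ≤ᵇ 1 then 1ℚ else 0ℚ

-- 1/(1 - t) = Σ t^m
geom : Series
geom _ = 1ℚ

-- Elements of Q[[t*]][x]: P n = coefficient of x^n (a series in t)
Poly : Set
Poly = ℕ → Series

-- multiplication: ordinary in x, Hadamard in t
_·ₚ_ : Poly → Poly → Poly
(P ·ₚ R) n m = sumℚ (map (λ a → (P a *ₕ R (n ∸ a)) m) (upTo (suc n)))

_+ₚ_ : Poly → Poly → Poly
(P +ₚ R) n = P n +ₛ R n

scaleₚ : ℚ → Poly → Poly
scaleₚ c P n = scaleₛ c (P n)

zeroₚ : Poly
zeroₚ _ _ = 0ℚ

sumₚ : List Poly → Poly
sumₚ = foldr _+ₚ_ zeroₚ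

_≋_ : Poly → Poly → Set
P ≋ R = ∀ n m → P n m ≡ R n m

monomial : ℕ → Series → Poly
monomial n c k = if k ≡ᵇ n then c else (λ _ → 0ℚ)

gSeries : ℕ → ℕ → Series
gSeries n j =
  scaleₛ (ℕtoℚ (2 ℕ.^ (2 ℕ.* j)))
    ((tₛ ^ₛ j) ·ₛ ((onePlusT ^ₛ (n ∸ 2 ℕ.* j)) ·ₛ (geom ^ₛ suc n)))

-- spanning elements: 1/(1-t)  and  gSeries n j · x^n  (n ≥ 1, 0 ≤ j ≤ ⌊n/2⌋)
-- image of the basis element [π]_lpk of length n with lpk value j
φ : ℕ → ℕ → Poly
φ zero j = monomial 0 geom
φ (suc n) j = monomial (suc n) (gSeries (suc n) j)

φperm : List ℕ → Poly
φperm π = φ (length π) (lpk π)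

_∼lpk_ : List ℕ → List ℕ → Set
π ∼lpk σ = (length π ≡ length σ) × (lpk π ≡ lpk σ)

-- some permutation of length n has lpk value k
-- (i.e. the lpk-class (n,k) is nonempty: a basis element of A_lpk in degree n)
Achieves : ℕ → ℕ → Set
Achieves n k = Σ (List ℕ) (λ π → IsPerm π × (length π ≡ n) × (lpk π ≡ k))

module Submission where

-- Idea.  Let oddFac l w count the factorizations of a word w into 2l+1
-- consecutive, possibly empty segments, alternately increasing and
-- decreasing.  It is a convolution (along deconcatenation) of monotone
-- indicators, and the shuffle/deconcatenation compatibility makes every such
-- convolution shuffle-multiplicative:  Σ_{τ ∈ S(π,σ)} oddFac l τ =
-- oddFac l π · oddFac l σ.  Appending letters one at a time, a recurrence on
-- power series in t shows that for a permutation w with n letters and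
-- lpk w = j, oddFac l w is the coefficient of t^l in
-- 4^j t^j (1+t)^(n-2j) / (1-t)^(n+1), i.e. in the t-part of φ[w].  Hence
-- (b1) is the multiplicativity of oddFac; these series form a triangular
-- family in t (the j-th starts at t^j), which gives the linear independence
-- (b2) and, via cancellation of multisets, shuffle-compatibility (a).  The
-- bound lpk ≤ n/2 falls out of the same recurrence, and explicit zigzag
-- permutations realize every value, giving (b3), (b4) and (c).

open import Defs
open import Data.Nat using (ℕ; zero; suc; _+_; _*_; _∸_; _^_; _/_; _<ᵇ_; _≤ᵇ_; _≡ᵇ_; _<_; _≤_; _≤?_; _≟_; z≤n; s≤s)
open import Data.Nat.Properties
open import Data.Nat.DivMod using (/-monoˡ-≤; m*n/n≡m; m/n*n≤m)
open import Data.Nat.Induction using (<-rec)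
open import Data.Nat.Tactic.RingSolver using (solve-∀)
open import Algebra.Properties.CommutativeSemigroup +-commutativeSemigroup using (x∙yz≈y∙xz)
open import Data.Bool using (Bool; true; false; if_then_else_; _∧_)
open import Data.Empty using (⊥-elim)
import Data.Integer as ℤ
import Data.Integer.Properties as ℤ
open import Data.Rational as ℚ using (ℚ; 0ℚ; 1ℚ; toℚᵘ)
import Data.Rational.Properties as ℚ
open import Data.Rational.Unnormalised as ℚᵘ using (mkℚᵘ; *≡*)
import Data.Rational.Unnormalised.Properties as ℚᵘ
open import Data.List using (List; []; _∷_; [_]; map; _++_; length; upTo; applyUpTo; initLast; _∷ʳ′_)
open import Data.List.Properties using (++-assoc; length-++; length-map; length-upTo; map-cong; upTo-∷ʳ)
open import Data.List.Reverse using (Reverse; reverseView; []; _∶_∶ʳ_)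
open import Data.List.Membership.Propositional using (_∈_; _∉_)
open import Data.List.Membership.Propositional.Properties using (∈-map⁻; ∈-++⁺ˡ; ∈-++⁺ʳ; ∈-++⁻; ∈-∃++; ∈-upTo⁺; ∈-upTo⁻)
open import Data.List.Membership.DecPropositional _≟_ using (_∈?_)
open import Data.List.Relation.Unary.Any using (here; there)
open import Data.List.Relation.Unary.All as All using (All; []; _∷_)
import Data.List.Relation.Unary.All.Properties as All
open import Data.List.Relation.Unary.AllPairs using (AllPairs; []; _∷_)
open import Data.List.Relation.Unary.Linked using (Linked; []; [-]; _∷_)
open import Data.List.Relation.Unary.Linked.Properties using (AllPairs⇒Linked)
open import Data.List.Relation.Unary.Unique.Propositional using (Unique)
open import Data.List.Relation.Unary.Unique.Propositional.Properties using (map⁺; upTo⁺)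
open import Data.List.Relation.Binary.Permutation.Propositional using (_↭_; ↭-refl; ↭-sym; ↭-trans; prep)
open import Data.List.Relation.Binary.Permutation.Propositional.Properties using () renaming (shift to ↭-shift)
open import Data.Product using (_×_; _,_; proj₁; proj₂; Σ)
open import Data.Sum using (_⊎_; inj₁; inj₂; [_,_]′)
open import Function using (_∘_)
open import Function.Bundles using (_⇔_; mk⇔)
open import Relation.Nullary using (¬_; yes; no)
open import Relation.Binary.Definitions using (tri<; tri≈; tri>)
open import Relation.Binary.PropositionalEquality hiding ([_])

Word : Set
Word = List ℕ

∑ : {A : Set} → List A → (A → ℕ) → ℕ
∑ [] f = 0
∑ (x ∷ xs) f = f x + ∑ xs f

module _ {A : Set} where

  ∑-++ : (xs ys : List A) (f : A → ℕ) → ∑ (xs ++ ys) f ≡ ∑ xs f + ∑ ys f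
  ∑-++ [] ys f = refl
  ∑-++ (x ∷ xs) ys f = trans (cong (f x +_) (∑-++ xs ys f)) (sym (+-assoc (f x) _ _))

  ∑-cong∈ : (xs : List A) {f g : A → ℕ} → (∀ x → x ∈ xs → f x ≡ g x) → ∑ xs f ≡ ∑ xs g
  ∑-cong∈ [] e = refl
  ∑-cong∈ (x ∷ xs) e = cong₂ _+_ (e x (here refl)) (∑-cong∈ xs (λ y y∈ → e y (there y∈)))

  ∑-cong : (xs : List A) {f g : A → ℕ} → (∀ x → f x ≡ g x) → ∑ xs f ≡ ∑ xs g
  ∑-cong xs e = ∑-cong∈ xs (λ x _ → e x)

  ∑-zero : (xs : List A) {f : A → ℕ} → (∀ x → x ∈ xs → f x ≡ 0) → ∑ xs f ≡ 0
  ∑-zero [] e = refl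
  ∑-zero (x ∷ xs) e = cong₂ _+_ (e x (here refl)) (∑-zero xs (λ y y∈ → e y (there y∈)))

  ∑-+ : (xs : List A) (f g : A → ℕ) → ∑ xs (λ x → f x + g x) ≡ ∑ xs f + ∑ xs g
  ∑-+ [] f g = refl
  ∑-+ (x ∷ xs) f g = trans (cong (f x + g x +_) (∑-+ xs f g)) (shuffle (f x) (g x) (∑ xs f) (∑ xs g))
    where
    shuffle : ∀ a b c d → a + b + (c + d) ≡ a + c + (b + d)
    shuffle = solve-∀

  ∑-*ˡ : (xs : List A) (c : ℕ) (f : A → ℕ) → ∑ xs (λ x → c * f x) ≡ c * ∑ xs f
  ∑-*ˡ [] c f = sym (*-zeroʳ c)
  ∑-*ˡ (x ∷ xs) c f = trans (cong (c * f x +_) (∑-*ˡ xs c f)) (sym (*-distribˡ-+ c (f x) _))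

  ∑-*ʳ : (xs : List A) (c : ℕ) (f : A → ℕ) → ∑ xs (λ x → f x * c) ≡ ∑ xs f * c
  ∑-*ʳ [] c f = refl
  ∑-*ʳ (x ∷ xs) c f = trans (cong (f x * c +_) (∑-*ʳ xs c f)) (sym (*-distribʳ-+ c (f x) _))

module _ {A B : Set} where

  ∑-map : (g : A → B) (xs : List A) (f : B → ℕ) → ∑ (map g xs) f ≡ ∑ xs (f ∘ g)
  ∑-map g [] f = refl
  ∑-map g (x ∷ xs) f = cong (f (g x) +_) (∑-map g xs f)

  ∑-product : (xs : List A) (ys : List B) (f : A → ℕ) (g : B → ℕ) →
              ∑ xs f * ∑ ys g ≡ ∑ xs (λ x → ∑ ys (λ y → f x * g y))
  ∑-product xs ys f g =
    trans (sym (∑-*ʳ xs (∑ ys g) f)) (∑-cong xs (λ x → sym (∑-*ˡ ys (f x) g)))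

guard : Bool → ℕ → ℕ
guard true n = n
guard false n = 0

guard-∧ : ∀ b c n → guard (b ∧ c) n ≡ guard b (guard c n)
guard-∧ true c n = refl
guard-∧ false c n = refl

guard-0 : ∀ b → guard b 0 ≡ 0
guard-0 true = refl
guard-0 false = refl

∑-guard : {A : Set} (xs : List A) (b : Bool) (f : A → ℕ) →
          ∑ xs (λ s → guard b (f s)) ≡ guard b (∑ xs f)
∑-guard xs true f = refl
∑-guard xs false f = ∑-zero xs (λ _ _ → refl)

shuffleSum : (Word → ℕ) → Word → Word → ℕ
shuffleSum F α β = ∑ (shuffles α β) F

shuffles-[]ʳ : ∀ u → shuffles u [] ≡ [ u ]
shuffles-[]ʳ [] = refl
shuffles-[]ʳ (x ∷ u) = refl

shuffleSum-[]ʳ : ∀ F u → shuffleSum F u [] ≡ F u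
shuffleSum-[]ʳ F u rewrite shuffles-[]ʳ u = +-identityʳ (F u)

shuffleSum-[]ˡ : ∀ F u → shuffleSum F [] u ≡ F u
shuffleSum-[]ˡ F u = +-identityʳ (F u)

shuffleSum-∷ : ∀ F x xs y ys → shuffleSum F (x ∷ xs) (y ∷ ys)
               ≡ shuffleSum (F ∘ (x ∷_)) xs (y ∷ ys) + shuffleSum (F ∘ (y ∷_)) (x ∷ xs) ys
shuffleSum-∷ F x xs y ys = trans (∑-++ (map (x ∷_) (shuffles xs (y ∷ ys))) _ F)
  (cong₂ _+_ (∑-map (x ∷_) (shuffles xs (y ∷ ys)) F) (∑-map (y ∷_) (shuffles (x ∷ xs) ys) F))

shuffleSum-+ : ∀ F G α β → shuffleSum (λ s → F s + G s) α β ≡ shuffleSum F α β + shuffleSum G α β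
shuffleSum-+ F G α β = ∑-+ (shuffles α β) F G

shuffleSum-*ˡ : ∀ c F α β → shuffleSum (λ s → c * F s) α β ≡ c * shuffleSum F α β
shuffleSum-*ˡ c F α β = ∑-*ˡ (shuffles α β) c F

splits : Word → List (Word × Word)
splits [] = [ ([] , []) ]
splits (x ∷ w) = ([] , x ∷ w) ∷ map (λ p → (x ∷ proj₁ p , proj₂ p)) (splits w)

splits-sound : ∀ w p → p ∈ splits w → proj₁ p ++ proj₂ p ≡ w
splits-sound [] p (here refl) = refl
splits-sound (x ∷ w) p (here refl) = refl
splits-sound (x ∷ w) p (there p∈) with ∈-map⁻ _ p∈
... | (q , q∈ , refl) = cong (x ∷_) (splits-sound w q q∈)

_⋆_ : (Word → ℕ) → (Word → ℕ) → Word → ℕ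
(F ⋆ G) w = ∑ (splits w) (λ p → F (proj₁ p) * G (proj₂ p))

⋆-∷ : ∀ F G x s → (F ⋆ G) (x ∷ s) ≡ F [] * G (x ∷ s) + ((F ∘ (x ∷_)) ⋆ G) s
⋆-∷ F G x s = cong (F [] * G (x ∷ s) +_) (∑-map _ (splits s) _)

splits-snoc : ∀ w y (F : Word × Word → ℕ) →
  ∑ (splits (w ++ [ y ])) F ≡ F (w ++ [ y ] , []) + ∑ (splits w) (λ p → F (proj₁ p , proj₂ p ++ [ y ]))
splits-snoc [] y F = x∙yz≈y∙xz (F ([] , [ y ])) (F ([ y ] , [])) 0
splits-snoc (x ∷ w) y F = begin
  F ([] , x ∷ w ++ [ y ]) + ∑ (map x∷ (splits (w ++ [ y ]))) F
    ≡⟨ cong (F ([] , x ∷ w ++ [ y ]) +_) (trans (∑-map x∷ (splits (w ++ [ y ])) F) (splits-snoc w y (F ∘ x∷))) ⟩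
  F ([] , x ∷ w ++ [ y ]) + (F (x ∷ w ++ [ y ] , []) + ∑ (splits w) (λ p → F (x ∷ proj₁ p , proj₂ p ++ [ y ])))
    ≡⟨ x∙yz≈y∙xz (F ([] , x ∷ w ++ [ y ])) (F (x ∷ w ++ [ y ] , [])) _ ⟩
  F (x ∷ w ++ [ y ] , []) + (F ([] , x ∷ w ++ [ y ]) + ∑ (splits w) (λ p → F (x ∷ proj₁ p , proj₂ p ++ [ y ])))
    ≡⟨ cong (λ s → F (x ∷ w ++ [ y ] , []) + (F ([] , x ∷ w ++ [ y ]) + s))
            (sym (∑-map x∷ (splits w) (λ p → F (proj₁ p , proj₂ p ++ [ y ])))) ⟩
  F (x ∷ w ++ [ y ] , []) + (F ([] , x ∷ w ++ [ y ]) + ∑ (map x∷ (splits w)) (λ p → F (proj₁ p , proj₂ p ++ [ y ]))) ∎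
  where
  open ≡-Reasoning
  x∷ : Word × Word → Word × Word
  x∷ p = (x ∷ proj₁ p , proj₂ p)

⋆-snoc : ∀ (F G : Word → ℕ) w y →
  (F ⋆ G) (w ++ [ y ]) ≡ F (w ++ [ y ]) * G [] + ∑ (splits w) (λ p → F (proj₁ p) * G (proj₂ p ++ [ y ]))
⋆-snoc F G w y = splits-snoc w y (λ p → F (proj₁ p) * G (proj₂ p))

-- The right-hand side of the shuffle/deconcatenation compatibility below:
-- split both words and shuffle the front parts and the back parts separately.
splitSum : (Word → ℕ) → (Word → ℕ) → Word → Word → ℕ
splitSum F G α β =
  ∑ (splits α) (λ p → ∑ (splits β) (λ q →
    shuffleSum F (proj₁ p) (proj₁ q) * shuffleSum G (proj₂ p) (proj₂ q)))

shuffleSum-⋆-∷ : ∀ F G x xs y ys →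
  shuffleSum (F ⋆ G) (x ∷ xs) (y ∷ ys)
  ≡ F [] * shuffleSum G (x ∷ xs) (y ∷ ys)
    + (shuffleSum ((F ∘ (x ∷_)) ⋆ G) xs (y ∷ ys) + shuffleSum ((F ∘ (y ∷_)) ⋆ G) (x ∷ xs) ys)
shuffleSum-⋆-∷ F G x xs y ys = begin
  shuffleSum (F ⋆ G) α β
    ≡⟨ shuffleSum-∷ (F ⋆ G) x xs y ys ⟩
  shuffleSum ((F ⋆ G) ∘ (x ∷_)) xs β + shuffleSum ((F ⋆ G) ∘ (y ∷_)) α ys
    ≡⟨ cong₂ _+_ (∑-cong (shuffles xs β) (⋆-∷ F G x)) (∑-cong (shuffles α ys) (⋆-∷ F G y)) ⟩
  shuffleSum (λ s → F [] * G (x ∷ s) + (Fx ⋆ G) s) xs β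
    + shuffleSum (λ s → F [] * G (y ∷ s) + (Fy ⋆ G) s) α ys
    ≡⟨ cong₂ _+_ (shuffleSum-+ _ _ xs β) (shuffleSum-+ _ _ α ys) ⟩
  (shuffleSum (λ s → F [] * G (x ∷ s)) xs β + P) + (shuffleSum (λ s → F [] * G (y ∷ s)) α ys + Q)
    ≡⟨ cong₂ _+_ (cong (_+ P) (shuffleSum-*ˡ (F []) _ xs β)) (cong (_+ Q) (shuffleSum-*ˡ (F []) _ α ys)) ⟩
  (F [] * Sx + P) + (F [] * Sy + Q)
    ≡⟨ regroup (F []) Sx Sy P Q ⟩
  F [] * (Sx + Sy) + (P + Q)
    ≡⟨ cong (λ s → F [] * s + (P + Q)) (sym (shuffleSum-∷ G x xs y ys)) ⟩
  F [] * shuffleSum G α β + (P + Q) ∎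
  where
  open ≡-Reasoning
  α = x ∷ xs
  β = y ∷ ys
  Fx = F ∘ (x ∷_)
  Fy = F ∘ (y ∷_)
  Sx = shuffleSum (G ∘ (x ∷_)) xs β
  Sy = shuffleSum (G ∘ (y ∷_)) α ys
  P = shuffleSum (Fx ⋆ G) xs β
  Q = shuffleSum (Fy ⋆ G) α ys
  regroup : ∀ c a b p q → (c * a + p) + (c * b + q) ≡ c * (a + b) + (p + q)
  regroup = solve-∀

splitSum-row : ∀ F G x y ys u v →
  ∑ (splits (y ∷ ys)) (λ q → shuffleSum F (x ∷ u) (proj₁ q) * shuffleSum G v (proj₂ q))
  ≡ shuffleSum (F ∘ (x ∷_)) u [] * shuffleSum G v (y ∷ ys)
    + (∑ (splits ys) (λ q → shuffleSum (F ∘ (x ∷_)) u (y ∷ proj₁ q) * shuffleSum G v (proj₂ q))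
     + ∑ (splits ys) (λ q → shuffleSum (F ∘ (y ∷_)) (x ∷ u) (proj₁ q) * shuffleSum G v (proj₂ q)))
splitSum-row F G x y ys u v = cong₂ _+_
  (cong (_* shuffleSum G v (y ∷ ys)) (trans (shuffleSum-[]ʳ F (x ∷ u)) (sym (shuffleSum-[]ʳ (F ∘ (x ∷_)) u))))
  (trans (∑-map _ (splits ys) _)
    (trans (∑-cong (splits ys) (λ q → trans (cong (_* shuffleSum G v (proj₂ q)) (shuffleSum-∷ F x u y (proj₁ q)))
                                            (*-distribʳ-+ (shuffleSum G v (proj₂ q))
                                              (shuffleSum (F ∘ (x ∷_)) u (y ∷ proj₁ q))
                                              (shuffleSum (F ∘ (y ∷_)) (x ∷ u) (proj₁ q)))))
           (∑-+ (splits ys) _ _)))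

-- Unfolding the right-hand side for two nonempty words: it satisfies the
-- same recursion as the left-hand side (shuffleSum-⋆-∷).
splitSum-∷ : ∀ F G x xs y ys →
  splitSum F G (x ∷ xs) (y ∷ ys)
  ≡ F [] * shuffleSum G (x ∷ xs) (y ∷ ys)
    + (splitSum (F ∘ (x ∷_)) G xs (y ∷ ys) + splitSum (F ∘ (y ∷_)) G (x ∷ xs) ys)
splitSum-∷ F G x xs y ys = begin
  splitSum F G α β
    ≡⟨ cong₂ _+_ (cong₂ _+_ (cong (_* shuffleSum G α β) (+-identityʳ (F []))) (∑-map _ (splits ys) _))
                 (∑-map _ (splits xs) _) ⟩
  (F [] * shuffleSum G α β + C) + ∑ (splits xs) (λ p → ∑ (splits β) (λ q →
      shuffleSum F (x ∷ proj₁ p) (proj₁ q) * shuffleSum G (proj₂ p) (proj₂ q)))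
    ≡⟨ cong ((F [] * shuffleSum G α β + C) +_)
            (trans (∑-cong (splits xs) (λ p → splitSum-row F G x y ys (proj₁ p) (proj₂ p)))
                   (trans (∑-+ (splits xs) _ _) (cong (A +_) (∑-+ (splits xs) _ _)))) ⟩
  (F [] * shuffleSum G α β + C) + (A + (B + D))
    ≡⟨ regroup (F [] * shuffleSum G α β) A B C D ⟩
  F [] * shuffleSum G α β + ((A + B) + (C + D))
    ≡⟨ cong₂ (λ s s′ → F [] * shuffleSum G α β + (s + s′)) (sym splitSum-x) (sym splitSum-y) ⟩
  F [] * shuffleSum G α β + (splitSum Fx G xs β + splitSum Fy G α ys) ∎
  where
  open ≡-Reasoning
  α = x ∷ xs
  β = y ∷ ys
  Fx = F ∘ (x ∷_)
  Fy = F ∘ (y ∷_)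
  A = ∑ (splits xs) (λ p → shuffleSum Fx (proj₁ p) [] * shuffleSum G (proj₂ p) β)
  B = ∑ (splits xs) (λ p → ∑ (splits ys) (λ q →
        shuffleSum Fx (proj₁ p) (y ∷ proj₁ q) * shuffleSum G (proj₂ p) (proj₂ q)))
  C = ∑ (splits ys) (λ q → shuffleSum Fy [] (proj₁ q) * shuffleSum G α (proj₂ q))
  D = ∑ (splits xs) (λ p → ∑ (splits ys) (λ q →
        shuffleSum Fy (x ∷ proj₁ p) (proj₁ q) * shuffleSum G (proj₂ p) (proj₂ q)))
  splitSum-x : splitSum Fx G xs β ≡ A + B
  splitSum-x = trans (∑-cong (splits xs) (λ p →
      cong (shuffleSum Fx (proj₁ p) [] * shuffleSum G (proj₂ p) β +_)
           (∑-map (λ q → (y ∷ proj₁ q , proj₂ q)) (splits ys)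
                  (λ q → shuffleSum Fx (proj₁ p) (proj₁ q) * shuffleSum G (proj₂ p) (proj₂ q)))))
    (∑-+ (splits xs) _ _)
  splitSum-y : splitSum Fy G α ys ≡ C + D
  splitSum-y = cong (C +_) (∑-map _ (splits xs) _)
  regroup : ∀ e a b c d → (e + c) + (a + (b + d)) ≡ e + ((a + b) + (c + d))
  regroup = solve-∀

-- Shuffle/deconcatenation compatibility: a shuffle of α and β, cut into a
-- front and a back part, is the same thing as a front part of α shuffled with
-- a front part of β, followed by the back parts shuffled.
shuffleSum-⋆ : ∀ F G α β → shuffleSum (F ⋆ G) α β ≡ splitSum F G α β
shuffleSum-⋆ F G [] β = cong (_+ 0) (∑-cong (splits β) (λ q →
  cong₂ _*_ (sym (shuffleSum-[]ˡ F (proj₁ q))) (sym (shuffleSum-[]ˡ G (proj₂ q)))))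
shuffleSum-⋆ F G (x ∷ xs) [] = trans (+-identityʳ _) (∑-cong (splits (x ∷ xs)) (λ p →
  trans (cong₂ _*_ (sym (shuffleSum-[]ʳ F (proj₁ p))) (sym (shuffleSum-[]ʳ G (proj₂ p))))
        (sym (+-identityʳ _))))
shuffleSum-⋆ F G (x ∷ xs) (y ∷ ys) = begin
  shuffleSum (F ⋆ G) (x ∷ xs) (y ∷ ys)
    ≡⟨ shuffleSum-⋆-∷ F G x xs y ys ⟩
  F [] * shuffleSum G (x ∷ xs) (y ∷ ys)
    + (shuffleSum ((F ∘ (x ∷_)) ⋆ G) xs (y ∷ ys) + shuffleSum ((F ∘ (y ∷_)) ⋆ G) (x ∷ xs) ys)
    ≡⟨ cong (F [] * shuffleSum G (x ∷ xs) (y ∷ ys) +_)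
            (cong₂ _+_ (shuffleSum-⋆ (F ∘ (x ∷_)) G xs (y ∷ ys)) (shuffleSum-⋆ (F ∘ (y ∷_)) G (x ∷ xs) ys)) ⟩
  F [] * shuffleSum G (x ∷ xs) (y ∷ ys)
    + (splitSum (F ∘ (x ∷_)) G xs (y ∷ ys) + splitSum (F ∘ (y ∷_)) G (x ∷ xs) ys)
    ≡⟨ sym (splitSum-∷ F G x xs y ys) ⟩
  splitSum F G (x ∷ xs) (y ∷ ys) ∎
  where open ≡-Reasoning

ShuffleMultiplicative : (Word → ℕ) → Set
ShuffleMultiplicative F = ∀ α β → Disjoint α β → shuffleSum F α β ≡ F α * F β

Disjoint-tailˡ : ∀ {x xs β} → Disjoint (x ∷ xs) β → Disjoint xs β
Disjoint-tailˡ d a b = d (there a) b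

Disjoint-tailʳ : ∀ {α y ys} → Disjoint α (y ∷ ys) → Disjoint α ys
Disjoint-tailʳ d a b = d a (there b)

Disjoint-heads : ∀ {x xs y ys} → Disjoint (x ∷ xs) (y ∷ ys) → x ≢ y
Disjoint-heads d x≡y = d (here refl) (here x≡y)

Disjoint-++ : ∀ u v {u′ v′} → Disjoint (u ++ v) (u′ ++ v′) → Disjoint u u′ × Disjoint v v′
Disjoint-++ u v {u′} d = (λ a b → d (∈-++⁺ˡ a) (∈-++⁺ˡ b)) , (λ a b → d (∈-++⁺ʳ u a) (∈-++⁺ʳ u′ b))

-- Convolution along deconcatenation preserves shuffle-multiplicativity: by
-- shuffleSum-⋆ the shuffle sum of F ⋆ G factors over the splits of α and β.
⋆-multiplicative : ∀ {F G} → ShuffleMultiplicative F → ShuffleMultiplicative G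
                   → ShuffleMultiplicative (F ⋆ G)
⋆-multiplicative {F} {G} mF mG α β d = begin
  shuffleSum (F ⋆ G) α β
    ≡⟨ shuffleSum-⋆ F G α β ⟩
  splitSum F G α β
    ≡⟨ ∑-cong∈ (splits α) (λ p p∈ → ∑-cong∈ (splits β) (λ q q∈ → factor p q p∈ q∈)) ⟩
  ∑ (splits α) (λ p → ∑ (splits β) (λ q → (F (proj₁ p) * G (proj₂ p)) * (F (proj₁ q) * G (proj₂ q))))
    ≡⟨ sym (∑-product (splits α) (splits β) _ _) ⟩
  (F ⋆ G) α * (F ⋆ G) β ∎
  where
  open ≡-Reasoning
  regroup : ∀ a b c d → (a * b) * (c * d) ≡ (a * c) * (b * d)
  regroup = solve-∀
  factor : ∀ p q → p ∈ splits α → q ∈ splits β →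
           shuffleSum F (proj₁ p) (proj₁ q) * shuffleSum G (proj₂ p) (proj₂ q)
           ≡ (F (proj₁ p) * G (proj₂ p)) * (F (proj₁ q) * G (proj₂ q))
  factor (u , v) (u′ , v′) p∈ q∈ =
    trans (cong₂ _*_ (mF u u′ (proj₁ parts)) (mG v v′ (proj₂ parts))) (regroup (F u) (F u′) (G v) (G v′))
    where
    parts : Disjoint u u′ × Disjoint v v′
    parts = Disjoint-++ u v (subst₂ Disjoint (sym (splits-sound α _ p∈)) (sym (splits-sound β _ q∈)) d)

guard-split : ∀ b₁ b₂ b₃ b₄ P Q →
  guard b₁ (guard (b₂ ∧ (b₃ ∧ b₄)) P) + guard b₃ (guard ((b₁ ∧ b₂) ∧ b₄) Q)
  ≡ guard ((b₁ ∧ b₂) ∧ (b₃ ∧ b₄)) (P + Q)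
guard-split true true true true P Q = refl
guard-split true true true false P Q = refl
guard-split true true false b₄ P Q = refl
guard-split true false true true P Q = refl
guard-split true false true false P Q = refl
guard-split true false false b₄ P Q = refl
guard-split false b₂ true true P Q = refl
guard-split false b₂ true false P Q = refl
guard-split false b₂ false b₄ P Q = refl

guard-comm : ∀ b c n → guard b (guard c n) ≡ guard c (guard b n)
guard-comm true c n = refl
guard-comm false c n = sym (guard-0 c)

record BoolOrder : Set where
  field
    lt : ℕ → ℕ → Bool
    lt-trans : ∀ a b c → lt a b ≡ true → lt b c ≡ true → lt a c ≡ true
    lt-compare : ∀ a b → a ≢ b → (lt a b ≡ true × lt b a ≡ false) ⊎ (lt b a ≡ true × lt a b ≡ false)

module Monotone (O : BoolOrder) where
  open BoolOrder O

  sorted : Word → ℕ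
  sorted [] = 1
  sorted (x ∷ []) = 1
  sorted (x ∷ y ∷ r) = guard (lt x y) (sorted (y ∷ r))

  below : ℕ → Word → Bool
  below x [] = true
  below x (y ∷ s) = lt x y ∧ below x s

  -- the same indicator, read as "each letter lies below all later ones",
  -- which is the form that interacts well with shuffling
  sorted′ : Word → ℕ
  sorted′ [] = 1
  sorted′ (x ∷ s) = guard (below x s) (sorted′ s)

  below-trans : ∀ x y s → lt x y ≡ true → below y s ≡ true → below x s ≡ true
  below-trans x y [] _ _ = refl
  below-trans x y (z ∷ s) x<y y<zs with lt y z in y<z
  ... | true rewrite lt-trans x y z x<y y<z = below-trans x y s x<y y<zs

  sorted≡sorted′ : ∀ w → sorted w ≡ sorted′ w
  sorted≡sorted′ [] = refl
  sorted≡sorted′ (x ∷ []) = refl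
  sorted≡sorted′ (x ∷ y ∷ r) = trans (cong (guard (lt x y)) (sorted≡sorted′ (y ∷ r))) (absorb (lt x y) refl)
    where
    absorb : ∀ b → lt x y ≡ b → guard b (guard (below y r) (sorted′ r))
                                ≡ guard (b ∧ below x r) (guard (below y r) (sorted′ r))
    absorb false _ = refl
    absorb true x<y with below y r in y<r
    ... | true rewrite below-trans x y r x<y y<r = refl
    ... | false = sym (guard-0 _)

  shuffleSum-below : ∀ x α β (h : Word → ℕ) →
    shuffleSum (λ s → guard (below x s) (h s)) α β ≡ guard (below x α ∧ below x β) (shuffleSum h α β)
  shuffleSum-below x [] β h with below x β
  ... | true = refl
  ... | false = refl
  shuffleSum-below x (a ∷ as) [] h =
    trans (shuffleSum-[]ʳ (λ s → guard (below x s) (h s)) (a ∷ as))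
          (trans (cong (λ b → guard b (h (a ∷ as))) (sym (∧-true _)))
                 (cong (guard (below x (a ∷ as) ∧ true)) (sym (shuffleSum-[]ʳ h (a ∷ as)))))
    where
    ∧-true : ∀ b → (b ∧ true) ≡ b
    ∧-true true = refl
    ∧-true false = refl
  shuffleSum-below x (a ∷ as) (b ∷ bs) h = begin
    shuffleSum H (a ∷ as) (b ∷ bs)
      ≡⟨ shuffleSum-∷ H a as b bs ⟩
    shuffleSum (H ∘ (a ∷_)) as (b ∷ bs) + shuffleSum (H ∘ (b ∷_)) (a ∷ as) bs
      ≡⟨ cong₂ _+_ (pull a as (b ∷ bs)) (pull b (a ∷ as) bs) ⟩
    guard (lt x a) (shuffleSum (λ s → guard (below x s) (h (a ∷ s))) as (b ∷ bs))
      + guard (lt x b) (shuffleSum (λ s → guard (below x s) (h (b ∷ s))) (a ∷ as) bs)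
      ≡⟨ cong₂ _+_ (cong (guard (lt x a)) (shuffleSum-below x as (b ∷ bs) (h ∘ (a ∷_))))
                   (cong (guard (lt x b)) (shuffleSum-below x (a ∷ as) bs (h ∘ (b ∷_)))) ⟩
    guard (lt x a) (guard (below x as ∧ (lt x b ∧ below x bs)) (shuffleSum (h ∘ (a ∷_)) as (b ∷ bs)))
      + guard (lt x b) (guard ((lt x a ∧ below x as) ∧ below x bs) (shuffleSum (h ∘ (b ∷_)) (a ∷ as) bs))
      ≡⟨ guard-split (lt x a) (below x as) (lt x b) (below x bs) _ _ ⟩
    guard (below x (a ∷ as) ∧ below x (b ∷ bs))
          (shuffleSum (h ∘ (a ∷_)) as (b ∷ bs) + shuffleSum (h ∘ (b ∷_)) (a ∷ as) bs)
      ≡⟨ cong (guard _) (sym (shuffleSum-∷ h a as b bs)) ⟩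
    guard (below x (a ∷ as) ∧ below x (b ∷ bs)) (shuffleSum h (a ∷ as) (b ∷ bs)) ∎
    where
    open ≡-Reasoning
    H : Word → ℕ
    H s = guard (below x s) (h s)
    pull : ∀ c u v → shuffleSum (H ∘ (c ∷_)) u v
                     ≡ guard (lt x c) (shuffleSum (λ s → guard (below x s) (h (c ∷ s))) u v)
    pull c u v = trans (∑-cong (shuffles u v) (λ s → guard-∧ (lt x c) (below x s) _))
                       (∑-guard (shuffles u v) (lt x c) _)

  -- The monotone indicator is shuffle-multiplicative: the smaller of the two
  -- first letters must come first, and then the rest is again a shuffle.
  sorted′-multiplicative : ShuffleMultiplicative sorted′
  sorted′-multiplicative [] β d = trans (+-identityʳ _) (sym (+-identityʳ _))
  sorted′-multiplicative (x ∷ xs) [] d = trans (shuffleSum-[]ʳ sorted′ (x ∷ xs)) (sym (*-identityʳ _))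
  sorted′-multiplicative (x ∷ xs) (y ∷ ys) d = begin
    shuffleSum sorted′ (x ∷ xs) (y ∷ ys)
      ≡⟨ shuffleSum-∷ sorted′ x xs y ys ⟩
    shuffleSum (λ s → guard (below x s) (sorted′ s)) xs (y ∷ ys)
      + shuffleSum (λ s → guard (below y s) (sorted′ s)) (x ∷ xs) ys
      ≡⟨ cong₂ _+_ (shuffleSum-below x xs (y ∷ ys) sorted′) (shuffleSum-below y (x ∷ xs) ys sorted′) ⟩
    guard (below x xs ∧ (lt x y ∧ below x ys)) (shuffleSum sorted′ xs (y ∷ ys))
      + guard ((lt y x ∧ below y xs) ∧ below y ys) (shuffleSum sorted′ (x ∷ xs) ys)
      ≡⟨ cong₂ _+_ (cong (guard (below x xs ∧ (lt x y ∧ below x ys)))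
                         (sorted′-multiplicative xs (y ∷ ys) (Disjoint-tailˡ d)))
                   (cong (guard ((lt y x ∧ below y xs) ∧ below y ys))
                         (sorted′-multiplicative (x ∷ xs) ys (Disjoint-tailʳ d))) ⟩
    guard (below x xs ∧ (lt x y ∧ below x ys)) (sorted′ xs * guard (below y ys) (sorted′ ys))
      + guard ((lt y x ∧ below y xs) ∧ below y ys) (guard (below x xs) (sorted′ xs) * sorted′ ys)
      ≡⟨ firstLetter (lt-compare x y (Disjoint-heads d)) ⟩
    sorted′ (x ∷ xs) * sorted′ (y ∷ ys) ∎
    where
    open ≡-Reasoning
    firstLetter : (lt x y ≡ true × lt y x ≡ false) ⊎ (lt y x ≡ true × lt x y ≡ false) →
      guard (below x xs ∧ (lt x y ∧ below x ys)) (sorted′ xs * guard (below y ys) (sorted′ ys))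
      + guard ((lt y x ∧ below y xs) ∧ below y ys) (guard (below x xs) (sorted′ xs) * sorted′ ys)
      ≡ guard (below x xs) (sorted′ xs) * guard (below y ys) (sorted′ ys)
    firstLetter (inj₁ (x<y , y≮x)) rewrite x<y | y≮x with below y ys in y<ys
    ... | true rewrite below-trans x y ys x<y y<ys with below x xs
    ...   | true = +-identityʳ _
    ...   | false = refl
    firstLetter (inj₁ (x<y , y≮x)) | false
      rewrite *-zeroʳ (sorted′ xs) | guard-0 (below x xs ∧ below x ys)
            | *-zeroʳ (guard (below x xs) (sorted′ xs)) = refl
    firstLetter (inj₂ (y<x , x≮y)) rewrite y<x | x≮y with below x xs in x<xs
    ... | false rewrite guard-0 (below y xs ∧ below y ys) = refl
    ... | true rewrite below-trans y x xs y<x x<xs with below y ys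
    ...   | true = refl
    ...   | false = sym (*-zeroʳ (sorted′ xs))

  sorted-multiplicative : ShuffleMultiplicative sorted
  sorted-multiplicative α β d = begin
    shuffleSum sorted α β   ≡⟨ ∑-cong (shuffles α β) sorted≡sorted′ ⟩
    shuffleSum sorted′ α β  ≡⟨ sorted′-multiplicative α β d ⟩
    sorted′ α * sorted′ β   ≡⟨ sym (cong₂ _*_ (sorted≡sorted′ α) (sorted≡sorted′ β)) ⟩
    sorted α * sorted β     ∎
    where open ≡-Reasoning

  sorted-snoc : ∀ v y z → sorted ((v ++ [ y ]) ++ [ z ]) ≡ guard (lt y z) (sorted (v ++ [ y ]))
  sorted-snoc v y z = trans (cong sorted (++-assoc v [ y ] [ z ])) (go v)
    where
    go : ∀ v → sorted (v ++ y ∷ z ∷ []) ≡ guard (lt y z) (sorted (v ++ [ y ]))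
    go [] = refl
    go (x ∷ []) = guard-comm (lt x y) (lt y z) 1
    go (x ∷ x′ ∷ v) = trans (cong (guard (lt x x′)) (go (x′ ∷ v))) (guard-comm (lt x x′) (lt y z) _)

  -- Convolving with the monotone indicator, viewed from the last letter: the
  -- final monotone segment is empty, or it contains the last letter z, in
  -- which case it may extend over the previous letter y exactly when lt y z.
  ⋆sorted-snoc : ∀ F v y z → (F ⋆ sorted) ((v ++ [ y ]) ++ [ z ])
    ≡ F ((v ++ [ y ]) ++ [ z ]) + (if lt y z then (F ⋆ sorted) (v ++ [ y ]) else F (v ++ [ y ]))
  ⋆sorted-snoc F v y z = begin
    (F ⋆ sorted) (W ++ [ z ])
      ≡⟨ ⋆-snoc F sorted W z ⟩
    F (W ++ [ z ]) * 1 + ∑ (splits W) (λ p → F (proj₁ p) * sorted (proj₂ p ++ [ z ]))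
      ≡⟨ cong₂ _+_ (*-identityʳ (F (W ++ [ z ]))) (splits-snoc v y (λ p → F (proj₁ p) * sorted (proj₂ p ++ [ z ]))) ⟩
    F (W ++ [ z ]) + (F W * 1 + ∑ (splits v) (λ p → F (proj₁ p) * sorted ((proj₂ p ++ [ y ]) ++ [ z ])))
      ≡⟨ cong (λ s → F (W ++ [ z ]) + (F W * 1 + s))
              (∑-cong (splits v) (λ p → cong (F (proj₁ p) *_) (sorted-snoc (proj₂ p) y z))) ⟩
    F (W ++ [ z ]) + (F W * 1 + ∑ (splits v) (λ p → F (proj₁ p) * guard (lt y z) (sorted (proj₂ p ++ [ y ]))))
      ≡⟨ cong (F (W ++ [ z ]) +_) (lastSegment (lt y z)) ⟩
    F (W ++ [ z ]) + (if lt y z then (F ⋆ sorted) W else F W) ∎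
    where
    open ≡-Reasoning
    W = v ++ [ y ]
    lastSegment : ∀ b → F W * 1 + ∑ (splits v) (λ p → F (proj₁ p) * guard b (sorted (proj₂ p ++ [ y ])))
                        ≡ (if b then (F ⋆ sorted) W else F W)
    lastSegment true = sym (⋆-snoc F sorted v y)
    lastSegment false = trans (cong₂ _+_ (*-identityʳ _) (∑-zero (splits v) (λ p _ → *-zeroʳ (F (proj₁ p)))))
                              (+-identityʳ _)

  ⋆sorted-single : ∀ F z → (F ⋆ sorted) [ z ] ≡ F [ z ] + F []
  ⋆sorted-single F z = trans (cong₂ _+_ (*-identityʳ (F [])) (trans (+-identityʳ (F [ z ] * 1)) (*-identityʳ (F [ z ]))))
                             (+-comm (F []) (F [ z ]))

<ᵇ-trans : ∀ a b c → (a <ᵇ b) ≡ true → (b <ᵇ c) ≡ true → (a <ᵇ c) ≡ true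
<ᵇ-trans zero (suc b) (suc c) _ _ = refl
<ᵇ-trans (suc a) (suc b) (suc c) a<b b<c = <ᵇ-trans a b c a<b b<c

<ᵇ-compare : ∀ a b → a ≢ b → ((a <ᵇ b) ≡ true × (b <ᵇ a) ≡ false) ⊎ ((b <ᵇ a) ≡ true × (a <ᵇ b) ≡ false)
<ᵇ-compare zero zero a≢b = ⊥-elim (a≢b refl)
<ᵇ-compare zero (suc b) _ = inj₁ (refl , refl)
<ᵇ-compare (suc a) zero _ = inj₂ (refl , refl)
<ᵇ-compare (suc a) (suc b) a≢b = <ᵇ-compare a b (a≢b ∘ cong suc)

increasing decreasing : BoolOrder
increasing = record { lt = _<ᵇ_ ; lt-trans = <ᵇ-trans ; lt-compare = <ᵇ-compare }
decreasing = record { lt = λ a b → b <ᵇ a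
                    ; lt-trans = λ a b c a>b b>c → <ᵇ-trans c b a b>c a>b
                    ; lt-compare = λ a b a≢b → <ᵇ-compare b a (a≢b ∘ sym) }

module Inc = Monotone increasing
module Dec = Monotone decreasing

isEmpty : Word → ℕ
isEmpty [] = 1
isEmpty (_ ∷ _) = 0

isEmpty-multiplicative : ShuffleMultiplicative isEmpty
isEmpty-multiplicative [] [] _ = refl
isEmpty-multiplicative [] (y ∷ ys) _ = refl
isEmpty-multiplicative (x ∷ xs) [] _ = refl
isEmpty-multiplicative (x ∷ xs) (y ∷ ys) _ = trans (shuffleSum-∷ isEmpty x xs y ys)
  (cong₂ _+_ (∑-zero (shuffles xs (y ∷ ys)) (λ _ _ → refl)) (∑-zero (shuffles (x ∷ xs) ys) (λ _ _ → refl)))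

-- Alternating factorizations.  oddFac l w counts the ways of cutting w into
-- 2l+1 consecutive (possibly empty) segments that are alternately increasing
-- and decreasing, the first and last increasing; evenFac l w does the same
-- with 2l segments, the last one decreasing.  They are convolutions of
-- monotone indicators, hence shuffle-multiplicative.
mutual
  oddFac : ℕ → Word → ℕ
  oddFac zero = Inc.sorted
  oddFac (suc l) = evenFac (suc l) ⋆ Inc.sorted

  evenFac : ℕ → Word → ℕ
  evenFac zero = isEmpty
  evenFac (suc l) = oddFac l ⋆ Dec.sorted

mutual
  oddFac-multiplicative : ∀ l → ShuffleMultiplicative (oddFac l)
  oddFac-multiplicative zero = Inc.sorted-multiplicative
  oddFac-multiplicative (suc l) = ⋆-multiplicative (evenFac-multiplicative (suc l)) Inc.sorted-multiplicative

  evenFac-multiplicative : ∀ l → ShuffleMultiplicative (evenFac l)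
  evenFac-multiplicative zero = isEmpty-multiplicative
  evenFac-multiplicative (suc l) = ⋆-multiplicative (oddFac-multiplicative l) Dec.sorted-multiplicative

mutual
  oddFac-[] : ∀ l → oddFac l [] ≡ 1
  oddFac-[] zero = refl
  oddFac-[] (suc l) = trans (+-identityʳ _) (trans (*-identityʳ _) (evenFac-[] (suc l)))

  evenFac-[] : ∀ l → evenFac l [] ≡ 1
  evenFac-[] zero = refl
  evenFac-[] (suc l) = trans (+-identityʳ _) (trans (*-identityʳ _) (oddFac-[] l))

isEmpty-snoc : ∀ w z → isEmpty (w ++ [ z ]) ≡ 0
isEmpty-snoc [] z = refl
isEmpty-snoc (x ∷ w) z = refl

oddFac₀-snoc : ∀ v y z → oddFac 0 ((v ++ [ y ]) ++ [ z ]) ≡ guard (y <ᵇ z) (oddFac 0 (v ++ [ y ]))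
oddFac₀-snoc = Inc.sorted-snoc

oddFac-snoc : ∀ l v y z → oddFac (suc l) ((v ++ [ y ]) ++ [ z ])
  ≡ evenFac (suc l) ((v ++ [ y ]) ++ [ z ])
    + (if y <ᵇ z then oddFac (suc l) (v ++ [ y ]) else evenFac (suc l) (v ++ [ y ]))
oddFac-snoc l = Inc.⋆sorted-snoc (evenFac (suc l))

evenFac-snoc : ∀ l v y z → evenFac (suc l) ((v ++ [ y ]) ++ [ z ])
  ≡ oddFac l ((v ++ [ y ]) ++ [ z ])
    + (if z <ᵇ y then evenFac (suc l) (v ++ [ y ]) else oddFac l (v ++ [ y ]))
evenFac-snoc l = Dec.⋆sorted-snoc (oddFac l)

Seq : Set
Seq = ℕ → ℕ

∑-applyUpTo : ∀ n (h F : ℕ → ℕ) → ∑ (applyUpTo h n) F ≡ ∑ (upTo n) (F ∘ h)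
∑-applyUpTo zero h F = refl
∑-applyUpTo (suc n) h F =
  cong (F (h 0) +_) (trans (∑-applyUpTo n (h ∘ suc) F) (sym (∑-applyUpTo n suc (F ∘ h))))

∑-upTo-first : ∀ n F → ∑ (upTo (suc n)) F ≡ F 0 + ∑ (upTo n) (F ∘ suc)
∑-upTo-first n F = cong (F 0 +_) (∑-applyUpTo n suc F)

∑-upTo-last : ∀ n F → ∑ (upTo (suc n)) F ≡ ∑ (upTo n) F + F n
∑-upTo-last n F = begin
  ∑ (upTo (suc n)) F        ≡⟨ cong (λ xs → ∑ xs F) (sym (upTo-∷ʳ n)) ⟩
  ∑ (upTo n ++ [ n ]) F     ≡⟨ ∑-++ (upTo n) [ n ] F ⟩
  ∑ (upTo n) F + (F n + 0)  ≡⟨ cong (∑ (upTo n) F +_) (+-identityʳ (F n)) ⟩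
  ∑ (upTo n) F + F n        ∎
  where open ≡-Reasoning

conv : Seq → Seq → Seq
conv f g m = ∑ (upTo (suc m)) (λ i → f i * g (m ∸ i))

oneᴺ tᴺ onePlusTᴺ geomᴺ : Seq
oneᴺ m = if m ≡ᵇ 0 then 1 else 0
tᴺ m = if m ≡ᵇ 1 then 1 else 0
onePlusTᴺ m = if m ≤ᵇ 1 then 1 else 0
geomᴺ _ = 1

powᴺ : Seq → ℕ → Seq
powᴺ f zero = oneᴺ
powᴺ f (suc k) = conv f (powᴺ f k)

shift : Seq → Seq
shift f zero = 0
shift f (suc m) = f m

shift-cong : ∀ {f g} → f ≗ g → shift f ≗ shift g
shift-cong e zero = refl
shift-cong e (suc m) = e m

conv-cong : ∀ {f f′ g g′} → f ≗ f′ → g ≗ g′ → conv f g ≗ conv f′ g′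
conv-cong {f} {f′} {g} {g′} ef eg m = ∑-cong (upTo (suc m)) (λ i → cong₂ _*_ (ef i) (eg (m ∸ i)))

conv-+ˡ : ∀ f f′ g → conv (λ i → f i + f′ i) g ≗ (λ m → conv f g m + conv f′ g m)
conv-+ˡ f f′ g m = trans (∑-cong (upTo (suc m)) (λ i → *-distribʳ-+ (g (m ∸ i)) (f i) (f′ i)))
                         (∑-+ (upTo (suc m)) (λ i → f i * g (m ∸ i)) (λ i → f′ i * g (m ∸ i)))

conv-+ʳ : ∀ f g g′ → conv f (λ i → g i + g′ i) ≗ (λ m → conv f g m + conv f g′ m)
conv-+ʳ f g g′ m = trans (∑-cong (upTo (suc m)) (λ i → *-distribˡ-+ (f i) (g (m ∸ i)) (g′ (m ∸ i))))
                         (∑-+ (upTo (suc m)) (λ i → f i * g (m ∸ i)) (λ i → f i * g′ (m ∸ i)))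

conv-shiftˡ : ∀ f g → conv (shift f) g ≗ shift (conv f g)
conv-shiftˡ f g zero = refl
conv-shiftˡ f g (suc m) = ∑-upTo-first (suc m) (λ i → shift f i * g (suc m ∸ i))

conv-shiftʳ : ∀ f g → conv f (shift g) ≗ shift (conv f g)
conv-shiftʳ f g zero = trans (+-identityʳ _) (*-zeroʳ (f 0))
conv-shiftʳ f g (suc m) = begin
  conv f (shift g) (suc m)
    ≡⟨ ∑-upTo-last (suc m) (λ i → f i * shift g (suc m ∸ i)) ⟩
  ∑ (upTo (suc m)) (λ i → f i * shift g (suc m ∸ i)) + f (suc m) * shift g (suc m ∸ suc m)
    ≡⟨ cong₂ _+_ (∑-cong∈ (upTo (suc m)) (λ i i∈ → cong (λ k → f i * shift g k)
                                            (+-∸-assoc 1 (≤-pred (∈-upTo⁻ i∈)))))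
                 (trans (cong (λ k → f (suc m) * shift g k) (n∸n≡0 m)) (*-zeroʳ (f (suc m)))) ⟩
  conv f g m + 0
    ≡⟨ +-identityʳ _ ⟩
  conv f g m ∎
  where open ≡-Reasoning

conv-oneˡ : ∀ g → conv oneᴺ g ≗ g
conv-oneˡ g m = trans (∑-upTo-first m _)
  (trans (cong₂ _+_ (+-identityʳ (g m)) (∑-zero (upTo m) (λ _ _ → refl))) (+-identityʳ (g m)))

conv-t : ∀ g → conv tᴺ g ≗ shift g
conv-t g m = trans (conv-cong {tᴺ} {shift oneᴺ} {g} {g} t≗ (λ _ → refl) m)
                   (trans (conv-shiftˡ oneᴺ g m) (shift-cong (conv-oneˡ g) m))
  where
  t≗ : tᴺ ≗ shift oneᴺ
  t≗ zero = refl
  t≗ (suc m) = refl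

conv-onePlusT : ∀ g → conv onePlusTᴺ g ≗ (λ i → g i + shift g i)
conv-onePlusT g m = begin
  conv onePlusTᴺ g m                           ≡⟨ conv-cong {g = g} {g} 1+t≗ (λ _ → refl) m ⟩
  conv (λ i → oneᴺ i + shift oneᴺ i) g m      ≡⟨ conv-+ˡ oneᴺ (shift oneᴺ) g m ⟩
  conv oneᴺ g m + conv (shift oneᴺ) g m        ≡⟨ cong₂ _+_ (conv-oneˡ g m) (conv-shiftˡ oneᴺ g m) ⟩
  g m + shift (conv oneᴺ g) m                  ≡⟨ cong (g m +_) (shift-cong (conv-oneˡ g) m) ⟩
  g m + shift g m                              ∎
  where
  open ≡-Reasoning
  1+t≗ : onePlusTᴺ ≗ (λ i → oneᴺ i + shift oneᴺ i)
  1+t≗ zero = refl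
  1+t≗ (suc zero) = refl
  1+t≗ (suc (suc m)) = refl

conv-geom : ∀ g → conv geomᴺ g ≗ (λ i → g i + shift (conv geomᴺ g) i)
conv-geom g m = begin
  conv geomᴺ g m                             ≡⟨ conv-cong {g = g} {g} geom≗ (λ _ → refl) m ⟩
  conv (λ i → oneᴺ i + shift geomᴺ i) g m   ≡⟨ conv-+ˡ oneᴺ (shift geomᴺ) g m ⟩
  conv oneᴺ g m + conv (shift geomᴺ) g m     ≡⟨ cong₂ _+_ (conv-oneˡ g m) (conv-shiftˡ geomᴺ g m) ⟩
  g m + shift (conv geomᴺ g) m               ∎
  where
  open ≡-Reasoning
  geom≗ : geomᴺ ≗ (λ i → oneᴺ i + shift geomᴺ i)
  geom≗ zero = refl
  geom≗ (suc m) = refl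

X : ℕ → ℕ → Seq
X b r = conv (powᴺ onePlusTᴺ b) (powᴺ geomᴺ r)

Y : ℕ → ℕ → ℕ → Seq
Y a b r = conv (powᴺ tᴺ a) (X b r)

X-sucˡ : ∀ b r → X (suc b) r ≗ (λ m → X b r m + shift (X b r) m)
X-sucˡ b r m = trans (conv-cong {g = powᴺ geomᴺ r} {powᴺ geomᴺ r} (conv-onePlusT (powᴺ onePlusTᴺ b)) (λ _ → refl) m)
  (trans (conv-+ˡ (powᴺ onePlusTᴺ b) (shift (powᴺ onePlusTᴺ b)) (powᴺ geomᴺ r) m)
         (cong (X b r m +_) (conv-shiftˡ (powᴺ onePlusTᴺ b) (powᴺ geomᴺ r) m)))

X-sucʳ : ∀ b r → X b (suc r) ≗ (λ m → X b r m + shift (X b (suc r)) m)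
X-sucʳ b r m = trans (conv-cong {powᴺ onePlusTᴺ b} {powᴺ onePlusTᴺ b} (λ _ → refl) (conv-geom (powᴺ geomᴺ r)) m)
  (trans (conv-+ʳ (powᴺ onePlusTᴺ b) (powᴺ geomᴺ r) (shift (powᴺ geomᴺ (suc r))) m)
         (cong (X b r m +_) (conv-shiftʳ (powᴺ onePlusTᴺ b) (powᴺ geomᴺ (suc r)) m)))

-- (1 + t) = (1 - t) + 2t, divided by (1 - t)^(r+1)
X-ascent : ∀ b r m → X (suc b) (suc r) m ≡ X b r m + 2 * shift (X b (suc r)) m
X-ascent b r m rewrite X-sucˡ b (suc r) m | X-sucʳ b r m = regroup (X b r m) (shift (X b (suc r)) m)
  where
  regroup : ∀ p q → p + q + q ≡ p + 2 * q
  regroup = solve-∀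

-- 2 = (1 - t) + (1 + t), divided by (1 - t)^(r+1)
X-descent : ∀ b r m → 2 * X b (suc r) m ≡ X b r m + X (suc b) (suc r) m
X-descent b r m rewrite X-sucˡ b (suc r) m | X-sucʳ b r m = regroup (X b r m) (shift (X b (suc r)) m)
  where
  regroup : ∀ p q → 2 * (p + q) ≡ p + (p + q + q)
  regroup = solve-∀

X-at-0 : ∀ b r → X b r 0 ≡ 1
X-at-0 zero zero = refl
X-at-0 (suc b) r = trans (X-sucˡ b r 0) (trans (+-identityʳ _) (X-at-0 b r))
X-at-0 zero (suc r) = trans (X-sucʳ 0 r 0) (trans (+-identityʳ _) (X-at-0 zero r))

Y-zero : ∀ b r → Y 0 b r ≗ X b r
Y-zero b r = conv-oneˡ (X b r)

Y-suc : ∀ a b r → Y (suc a) b r ≗ shift (Y a b r)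
Y-suc a b r m = trans (conv-cong {g = X b r} {X b r} (conv-t (powᴺ tᴺ a)) (λ _ → refl) m) (conv-shiftˡ (powᴺ tᴺ a) (X b r) m)

Y-ascent : ∀ a b r l → Y a (suc b) (suc r) l ≡ Y a b r l + 2 * Y (suc a) b (suc r) l
Y-ascent zero b r l =
  trans (Y-zero (suc b) (suc r) l)
        (trans (X-ascent b r l)
               (sym (cong₂ _+_ (Y-zero b r l)
                               (cong (2 *_) (trans (Y-suc 0 b (suc r) l) (shift-cong (Y-zero b (suc r)) l))))))
Y-ascent (suc a) b r zero
  rewrite Y-suc a (suc b) (suc r) zero | Y-suc a b r zero | Y-suc (suc a) b (suc r) zero = refl
Y-ascent (suc a) b r (suc l)
  rewrite Y-suc a (suc b) (suc r) (suc l) | Y-suc a b r (suc l) | Y-suc (suc a) b (suc r) (suc l) = Y-ascent a b r l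

Y-descent : ∀ a b r l → 2 * Y a b (suc r) l ≡ Y a b r l + Y a (suc b) (suc r) l
Y-descent zero b r l rewrite Y-zero b (suc r) l | Y-zero b r l | Y-zero (suc b) (suc r) l = X-descent b r l
Y-descent (suc a) b r zero
  rewrite Y-suc a b (suc r) zero | Y-suc a b r zero | Y-suc a (suc b) (suc r) zero = refl
Y-descent (suc a) b r (suc l)
  rewrite Y-suc a b (suc r) (suc l) | Y-suc a b r (suc l) | Y-suc a (suc b) (suc r) (suc l) = Y-descent a b r l

Y-below : ∀ a b r l → l < a → Y a b r l ≡ 0
Y-below (suc a) b r zero _ = Y-suc a b r zero
Y-below (suc a) b r (suc l) (s≤s l<a) = trans (Y-suc a b r (suc l)) (Y-below a b r l l<a)

Y-lowest : ∀ a b r → Y a b r a ≡ 1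
Y-lowest zero b r = trans (Y-zero b r 0) (X-at-0 b r)
Y-lowest (suc a) b r = trans (Y-suc a b r (suc a)) (Y-lowest a b r)

Y-geom : ∀ l → Y 0 0 1 l ≡ 1
Y-geom l = trans (Y-zero 0 1 l) (go l)
  where
  go : ∀ l → X 0 1 l ≡ 1
  go zero = trans (X-sucʳ 0 0 0) (trans (+-identityʳ _) (conv-oneˡ oneᴺ 0))
  go (suc l) = trans (X-sucʳ 0 0 (suc l)) (trans (cong (_+ X 0 1 l) (conv-oneˡ oneᴺ (suc l))) (go l))

pow4 : ℕ → ℕ
pow4 j = 2 ^ (2 * j)

pow4-suc : ∀ j → pow4 (suc j) ≡ 2 * (2 * pow4 j)
pow4-suc j = cong (2 ^_) (double-suc j)
  where
  double-suc : ∀ j → 2 * suc j ≡ suc (suc (2 * j))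
  double-suc = solve-∀

-- Appending a rise y < z to a word, in terms of coefficient sequences: c, d
-- are the new odd/even factorization counts and c₀ the old odd count.  The
-- recurrences below turn c₀ = k t^j (1+t)^b / (1-t)^r into
-- c = k t^j (1+t)^(b+1) / (1-t)^(r+1) and d = 2k t^(j+1) (1+t)^b / (1-t)^(r+1).
ascent-step : ∀ (k j b r : ℕ) (c d c₀ : Seq) → (∀ l → c₀ l ≡ k * Y j b r l)
  → c 0 ≡ c₀ 0 → d 0 ≡ 0 → (∀ l → d (suc l) ≡ c l + c₀ l) → (∀ l → c (suc l) ≡ d (suc l) + c₀ (suc l))
  → ∀ l → (c l ≡ k * Y j (suc b) (suc r) l) × (d l ≡ 2 * k * Y (suc j) b (suc r) l)
ascent-step k j b r c d c₀ hc₀ c0 d0 hd hc zero =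
  trans c0 (trans (hc₀ 0) (cong (k *_) (sym (trans (Y-ascent j b r 0)
    (trans (cong (λ t → Y j b r 0 + 2 * t) (Y-suc j b (suc r) 0)) (+-identityʳ _))))))
  , trans d0 (sym (trans (cong (2 * k *_) (Y-suc j b (suc r) 0)) (*-zeroʳ (2 * k))))
ascent-step k j b r c d c₀ hc₀ c0 d0 hd hc (suc l) = c-suc , d-suc
  where
  open ≡-Reasoning
  previous = ascent-step k j b r c d c₀ hc₀ c0 d0 hd hc l
  d-suc : d (suc l) ≡ 2 * k * Y (suc j) b (suc r) (suc l)
  d-suc = begin
    d (suc l)                                             ≡⟨ hd l ⟩
    c l + c₀ l                                            ≡⟨ cong₂ _+_ (proj₁ previous) (hc₀ l) ⟩
    k * Y j (suc b) (suc r) l + k * Y j b r l             ≡⟨ sym (*-distribˡ-+ k _ _) ⟩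
    k * (Y j (suc b) (suc r) l + Y j b r l)               ≡⟨ cong (k *_) (+-comm _ (Y j b r l)) ⟩
    k * (Y j b r l + Y j (suc b) (suc r) l)               ≡⟨ cong (k *_) (sym (Y-descent j b r l)) ⟩
    k * (2 * Y j b (suc r) l)                             ≡⟨ regroup k (Y j b (suc r) l) ⟩
    2 * k * Y j b (suc r) l                               ≡⟨ cong (2 * k *_) (sym (Y-suc j b (suc r) (suc l))) ⟩
    2 * k * Y (suc j) b (suc r) (suc l)                   ∎
    where
    regroup : ∀ k p → k * (2 * p) ≡ 2 * k * p
    regroup = solve-∀
  c-suc : c (suc l) ≡ k * Y j (suc b) (suc r) (suc l)
  c-suc = begin
    c (suc l)                                                   ≡⟨ hc l ⟩
    d (suc l) + c₀ (suc l)                                      ≡⟨ cong₂ _+_ d-suc (hc₀ (suc l)) ⟩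
    2 * k * Y (suc j) b (suc r) (suc l) + k * Y j b r (suc l)   ≡⟨ regroup k _ _ ⟩
    k * (Y j b r (suc l) + 2 * Y (suc j) b (suc r) (suc l))     ≡⟨ cong (k *_) (sym (Y-ascent j b r (suc l))) ⟩
    k * Y j (suc b) (suc r) (suc l)                             ∎
    where
    regroup : ∀ k p q → 2 * k * p + k * q ≡ k * (q + 2 * p)
    regroup = solve-∀

-- Appending a fall z < y: c, d are the new odd/even counts and d₀ the old
-- even count.  The recurrences turn d₀ = 2k t^(a+1) (1+t)^b / (1-t)^r into
-- c = 4k t^(a+1) (1+t)^b / (1-t)^(r+1) and d = 2k t^(a+1) (1+t)^(b+1) / (1-t)^(r+1).
descent-step : ∀ (k a b r : ℕ) (c d d₀ : Seq) → (∀ l → d₀ l ≡ 2 * k * Y (suc a) b r l)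
  → c 0 ≡ 0 → d 0 ≡ 0 → (∀ l → d (suc l) ≡ c l + d₀ (suc l)) → (∀ l → c (suc l) ≡ d (suc l) + d₀ (suc l))
  → ∀ l → (c l ≡ 2 * (2 * k) * Y (suc a) b (suc r) l) × (d l ≡ 2 * k * Y (suc a) (suc b) (suc r) l)
descent-step k a b r c d d₀ hd₀ c0 d0 hd hc zero =
  trans c0 (sym (trans (cong (2 * (2 * k) *_) (Y-suc a b (suc r) 0)) (*-zeroʳ (2 * (2 * k)))))
  , trans d0 (sym (trans (cong (2 * k *_) (Y-suc a (suc b) (suc r) 0)) (*-zeroʳ (2 * k))))
descent-step k a b r c d d₀ hd₀ c0 d0 hd hc (suc l) = c-suc , d-suc
  where
  open ≡-Reasoning
  previous = descent-step k a b r c d d₀ hd₀ c0 d0 hd hc l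
  d-suc : d (suc l) ≡ 2 * k * Y (suc a) (suc b) (suc r) (suc l)
  d-suc = begin
    d (suc l)                                                               ≡⟨ hd l ⟩
    c l + d₀ (suc l)                                                        ≡⟨ cong₂ _+_ (proj₁ previous) (hd₀ (suc l)) ⟩
    2 * (2 * k) * Y (suc a) b (suc r) l + 2 * k * Y (suc a) b r (suc l)
      ≡⟨ cong (λ t → 2 * (2 * k) * t + 2 * k * Y (suc a) b r (suc l)) (sym (Y-suc (suc a) b (suc r) (suc l))) ⟩
    2 * (2 * k) * Y (suc (suc a)) b (suc r) (suc l) + 2 * k * Y (suc a) b r (suc l)
      ≡⟨ regroup k _ _ ⟩
    2 * k * (Y (suc a) b r (suc l) + 2 * Y (suc (suc a)) b (suc r) (suc l))
      ≡⟨ cong (2 * k *_) (sym (Y-ascent (suc a) b r (suc l))) ⟩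
    2 * k * Y (suc a) (suc b) (suc r) (suc l)                               ∎
    where
    regroup : ∀ k p q → 2 * (2 * k) * p + 2 * k * q ≡ 2 * k * (q + 2 * p)
    regroup = solve-∀
  c-suc : c (suc l) ≡ 2 * (2 * k) * Y (suc a) b (suc r) (suc l)
  c-suc = begin
    c (suc l)                                                               ≡⟨ hc l ⟩
    d (suc l) + d₀ (suc l)                                                  ≡⟨ cong₂ _+_ d-suc (hd₀ (suc l)) ⟩
    2 * k * Y (suc a) (suc b) (suc r) (suc l) + 2 * k * Y (suc a) b r (suc l)
      ≡⟨ regroup k _ _ ⟩
    2 * k * (Y (suc a) b r (suc l) + Y (suc a) (suc b) (suc r) (suc l))
      ≡⟨ cong (2 * k *_) (sym (Y-descent (suc a) b r (suc l))) ⟩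
    2 * k * (2 * Y (suc a) b (suc r) (suc l))
      ≡⟨ regroup′ k _ ⟩
    2 * (2 * k) * Y (suc a) b (suc r) (suc l)                               ∎
    where
    regroup : ∀ k p q → 2 * k * p + 2 * k * q ≡ 2 * k * (q + p)
    regroup = solve-∀
    regroup′ : ∀ k p → 2 * k * (2 * p) ≡ 2 * (2 * k) * p
    regroup′ = solve-∀

peakAt : ℕ → ℕ → ℕ → ℕ
peakAt a b c = if (a <ᵇ b) ∧ (c <ᵇ b) then 1 else 0

peaks-snoc : ∀ u x y z → peaks (u ++ x ∷ y ∷ z ∷ []) ≡ peaks (u ++ x ∷ y ∷ []) + peakAt x y z
peaks-snoc [] x y z = +-identityʳ (peakAt x y z)
peaks-snoc (a ∷ []) x y z =
  trans (cong (peakAt a x y +_) (peaks-snoc [] x y z)) (sym (+-assoc (peakAt a x y) 0 (peakAt x y z)))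
peaks-snoc (a ∷ b ∷ []) x y z =
  trans (cong (peakAt a b x +_) (peaks-snoc (b ∷ []) x y z)) (sym (+-assoc (peakAt a b x) _ (peakAt x y z)))
peaks-snoc (a ∷ b ∷ c ∷ u) x y z =
  trans (cong (peakAt a b c +_) (peaks-snoc (b ∷ c ∷ u) x y z)) (sym (+-assoc (peakAt a b c) _ (peakAt x y z)))

-- Consequently lpk, whose extra left-end term is unaffected, changes the same way.
lpk-snoc : ∀ u x y z → lpk (((u ++ [ x ]) ++ [ y ]) ++ [ z ]) ≡ lpk ((u ++ [ x ]) ++ [ y ]) + peakAt x y z
lpk-snoc u x y z
  rewrite ++-assoc (u ++ [ x ]) [ y ] [ z ] | ++-assoc u [ x ] (y ∷ z ∷ []) | ++-assoc u [ x ] [ y ] = go u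
  where
  descentAt : ℕ → ℕ → ℕ
  descentAt a b = if b <ᵇ a then 1 else 0
  go : ∀ u → lpk (u ++ x ∷ y ∷ z ∷ []) ≡ lpk (u ++ x ∷ y ∷ []) + peakAt x y z
  go [] = trans (cong (descentAt x y +_) (peaks-snoc [] x y z)) (sym (+-assoc (descentAt x y) _ (peakAt x y z)))
  go (a ∷ []) =
    trans (cong (descentAt a x +_) (peaks-snoc (a ∷ []) x y z)) (sym (+-assoc (descentAt a x) _ (peakAt x y z)))
  go (a ∷ b ∷ u) =
    trans (cong (descentAt a b +_) (peaks-snoc (a ∷ b ∷ u) x y z)) (sym (+-assoc (descentAt a b) _ (peakAt x y z)))

RisesTo : Word → ℕ → Set
RisesTo v y = v ≡ [] ⊎ Σ Word (λ u → Σ ℕ (λ x → v ≡ u ++ [ x ] × (x <ᵇ y) ≡ true))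

FallsTo : Word → ℕ → Set
FallsTo v y = Σ Word (λ u → Σ ℕ (λ x → v ≡ u ++ [ x ] × (y <ᵇ x) ≡ true))

∧-false : ∀ b → (b ∧ false) ≡ false
∧-false true = refl
∧-false false = refl

<ᵇ-asym : ∀ a b → (a <ᵇ b) ≡ true → (b <ᵇ a) ≡ false
<ᵇ-asym zero (suc b) _ = refl
<ᵇ-asym (suc a) (suc b) a<b = <ᵇ-asym a b a<b

lpk-no-new-peak : ∀ u x y z → ((x <ᵇ y) ∧ (z <ᵇ y)) ≡ false
                  → lpk (((u ++ [ x ]) ++ [ y ]) ++ [ z ]) ≡ lpk ((u ++ [ x ]) ++ [ y ])
lpk-no-new-peak u x y z noPeak =
  trans (lpk-snoc u x y z) (trans (cong (λ b → _ + (if b then 1 else 0)) noPeak) (+-identityʳ _))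

lpk-rise : ∀ v y z → (z <ᵇ y) ≡ false → lpk ((v ++ [ y ]) ++ [ z ]) ≡ lpk (v ++ [ y ])
lpk-rise v y z z≮y with initLast v
... | [] = cong (λ b → (if b then 1 else 0) + 0) z≮y
... | u ∷ʳ′ x = lpk-no-new-peak u x y z (trans (cong ((x <ᵇ y) ∧_) z≮y) (∧-false (x <ᵇ y)))

lpk-new-peak : ∀ v y z → RisesTo v y → (z <ᵇ y) ≡ true → lpk ((v ++ [ y ]) ++ [ z ]) ≡ suc (lpk (v ++ [ y ]))
lpk-new-peak .[] y z (inj₁ refl) z<y = cong (λ b → (if b then 1 else 0) + 0) z<y
lpk-new-peak .(u ++ [ x ]) y z (inj₂ (u , x , refl , x<y)) z<y =
  trans (lpk-snoc u x y z)
        (trans (cong (λ b → lpk ((u ++ [ x ]) ++ [ y ]) + (if b then 1 else 0))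
                     (trans (cong (_∧ (z <ᵇ y)) x<y) z<y))
               (+-comm _ 1))

lpk-valley : ∀ v y z → FallsTo v y → lpk ((v ++ [ y ]) ++ [ z ]) ≡ lpk (v ++ [ y ])
lpk-valley .(u ++ [ x ]) y z (u , x , refl , y<x) =
  lpk-no-new-peak u x y z (cong (_∧ (z <ᵇ y)) (<ᵇ-asym y x y<x))

length-snoc : ∀ (w : Word) z → length (w ++ [ z ]) ≡ suc (length w)
length-snoc w z = trans (length-++ w) (+-comm (length w) 1)

-- Closed forms of the factorization counts of a nonempty word W with j left
-- peaks, n = length W letters and adjacent letters distinct, according to
-- whether W ends in a rise or a fall:
--   ends in a rise:  oddFac = 4^j t^j (1+t)^(n-2j) / (1-t)^(n+1),
--                    evenFac = 2·4^j t^(j+1) (1+t)^(n-2j-1) / (1-t)^(n+1);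
--   ends in a fall:  oddFac as above, evenFac = 2·4^(j-1) t^j (1+t)^(n-2j+1) / (1-t)^(n+1).
data Profile (W : Word) : Set where
  endsUp : ∀ v y j b → W ≡ v ++ [ y ] → RisesTo v y → lpk W ≡ j → length W ≡ 2 * j + suc b
    → (∀ l → oddFac l W ≡ pow4 j * Y j (suc b) (suc (length W)) l)
    → (∀ l → evenFac l W ≡ 2 * pow4 j * Y (suc j) b (suc (length W)) l)
    → Profile W
  endsDown : ∀ v y i b → W ≡ v ++ [ y ] → FallsTo v y → lpk W ≡ suc i → length W ≡ 2 * suc i + b
    → (∀ l → oddFac l W ≡ pow4 (suc i) * Y (suc i) b (suc (length W)) l)
    → (∀ l → evenFac l W ≡ 2 * pow4 i * Y (suc i) (suc b) (suc (length W)) l)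
    → Profile W

-- Appending a rise: the recurrences of oddFac-snoc/evenFac-snoc are those of ascent-step.
appendRise : ∀ v y z j b → (y <ᵇ z) ≡ true → (z <ᵇ y) ≡ false
  → lpk ((v ++ [ y ]) ++ [ z ]) ≡ j → length (v ++ [ y ]) ≡ 2 * j + b
  → (∀ l → oddFac l (v ++ [ y ]) ≡ pow4 j * Y j b (suc (length (v ++ [ y ]))) l)
  → Profile ((v ++ [ y ]) ++ [ z ])
appendRise v y z j b y<z z≮y hlpk hlen hodd =
  endsUp W z j b refl (inj₂ (v , y , refl , y<z)) hlpk
    (trans (length-snoc W z) (trans (cong suc hlen) (sym (+-suc (2 * j) b))))
    (λ l → trans (proj₁ (counts l)) (cong (λ r → pow4 j * Y j (suc b) r l) newLength))
    (λ l → trans (proj₂ (counts l)) (cong (λ r → 2 * pow4 j * Y (suc j) b r l) newLength))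
  where
  W = v ++ [ y ]
  newLength : suc (suc (length W)) ≡ suc (length (W ++ [ z ]))
  newLength = cong suc (sym (length-snoc W z))
  counts = ascent-step (pow4 j) j b (suc (length W)) (λ l → oddFac l (W ++ [ z ])) (λ l → evenFac l (W ++ [ z ]))
    (λ l → oddFac l W) hodd
    (trans (oddFac₀-snoc v y z) (cong (λ t → guard t (oddFac 0 W)) y<z)) (isEmpty-snoc W z)
    (λ l → trans (evenFac-snoc l v y z) (cong (λ t → oddFac l (W ++ [ z ]) + (if t then evenFac (suc l) W else oddFac l W)) z≮y))
    (λ l → trans (oddFac-snoc l v y z) (cong (λ t → evenFac (suc l) (W ++ [ z ]) + (if t then oddFac (suc l) W else evenFac (suc l) W)) y<z))

-- Appending a fall: the recurrences are those of descent-step.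
appendFall : ∀ v y z i b → (z <ᵇ y) ≡ true → (y <ᵇ z) ≡ false
  → lpk ((v ++ [ y ]) ++ [ z ]) ≡ suc i → length (v ++ [ y ]) ≡ 2 * i + suc b
  → (∀ l → evenFac l (v ++ [ y ]) ≡ 2 * pow4 i * Y (suc i) b (suc (length (v ++ [ y ]))) l)
  → Profile ((v ++ [ y ]) ++ [ z ])
appendFall v y z i b z<y y≮z hlpk hlen heven =
  endsDown W z i b refl (v , y , refl , z<y) hlpk
    (trans (length-snoc W z) (trans (cong suc hlen) (sym (lengthArith i b))))
    (λ l → trans (proj₁ (counts l)) (cong₂ (λ k r → k * Y (suc i) b r l) (sym (pow4-suc i)) newLength))
    (λ l → trans (proj₂ (counts l)) (cong (λ r → 2 * pow4 i * Y (suc i) (suc b) r l) newLength))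
  where
  W = v ++ [ y ]
  lengthArith : ∀ i b → 2 * suc i + b ≡ suc (2 * i + suc b)
  lengthArith = solve-∀
  newLength : suc (suc (length W)) ≡ suc (length (W ++ [ z ]))
  newLength = cong suc (sym (length-snoc W z))
  counts = descent-step (pow4 i) i b (suc (length W)) (λ l → oddFac l (W ++ [ z ])) (λ l → evenFac l (W ++ [ z ]))
    (λ l → evenFac l W) heven
    (trans (oddFac₀-snoc v y z) (cong (λ t → guard t (oddFac 0 W)) y≮z)) (isEmpty-snoc W z)
    (λ l → trans (evenFac-snoc l v y z) (cong (λ t → oddFac l (W ++ [ z ]) + (if t then evenFac (suc l) W else oddFac l W)) z<y))
    (λ l → trans (oddFac-snoc l v y z) (cong (λ t → evenFac (suc l) (W ++ [ z ]) + (if t then oddFac (suc l) W else evenFac (suc l) W)) y≮z))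

-- A single letter ends in a rise: its counts come from the empty word by ascent-step.
profile-single : ∀ z → Profile [ z ]
profile-single z = endsUp [] z 0 0 refl (inj₁ refl) refl refl (λ l → proj₁ (counts l)) (λ l → proj₂ (counts l))
  where
  counts = ascent-step 1 0 0 1 (λ l → oddFac l [ z ]) (λ l → evenFac l [ z ]) (λ l → oddFac l [])
    (λ l → trans (oddFac-[] l) (sym (trans (+-identityʳ _) (Y-geom l)))) refl refl
    (λ l → Dec.⋆sorted-single (oddFac l) z)
    (λ l → trans (Inc.⋆sorted-single (evenFac (suc l)) z)
                 (cong (evenFac (suc l) [ z ] +_) (trans (evenFac-[] (suc l)) (sym (oddFac-[] (suc l))))))

Linked-init : ∀ {R : ℕ → ℕ → Set} w z → Linked R (w ++ [ z ]) → Linked R w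
Linked-init [] z _ = []
Linked-init (x ∷ []) z _ = [-]
Linked-init (x ∷ y ∷ w) z (r ∷ rs) = r ∷ Linked-init (y ∷ w) z rs

Linked-last : ∀ {R : ℕ → ℕ → Set} v y z → Linked R ((v ++ [ y ]) ++ [ z ]) → R y z
Linked-last {R} v y z rs = go v (subst (Linked R) (++-assoc v [ y ] [ z ]) rs)
  where
  go : ∀ v → Linked R (v ++ y ∷ z ∷ []) → R y z
  go [] (r ∷ _) = r
  go (x ∷ []) (_ ∷ r ∷ _) = r
  go (x ∷ x′ ∷ v) (_ ∷ rs) = go (x′ ∷ v) rs

profile-snoc : ∀ W z → Profile W → Linked _≢_ (W ++ [ z ]) → Profile (W ++ [ z ])
profile-snoc W z (endsUp v y j b refl rises hl hlen hodd heven) adj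
  with <ᵇ-compare y z (Linked-last v y z adj)
... | inj₁ (y<z , z≮y) = appendRise v y z j (suc b) y<z z≮y (trans (lpk-rise v y z z≮y) hl) hlen hodd
... | inj₂ (z<y , y≮z) = appendFall v y z j b z<y y≮z (trans (lpk-new-peak v y z rises z<y) (cong suc hl)) hlen heven
profile-snoc W z (endsDown v y i b refl falls hl hlen hodd heven) adj
  with <ᵇ-compare y z (Linked-last v y z adj)
... | inj₁ (y<z , z≮y) = appendRise v y z (suc i) b y<z z≮y (trans (lpk-rise v y z z≮y) hl) hlen hodd
... | inj₂ (z<y , y≮z) =
  appendFall v y z i (suc b) z<y y≮z (trans (lpk-valley v y z falls) hl) (trans hlen (lengthArith i b)) heven
  where
  lengthArith : ∀ i b → 2 * suc i + b ≡ 2 * i + suc (suc b)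
  lengthArith = solve-∀

profile : ∀ {W} → Reverse W → Linked _≢_ W → W ≡ [] ⊎ Profile W
profile [] _ = inj₁ refl
profile (w ∶ rw ∶ʳ z) adj with profile rw (Linked-init w z adj)
... | inj₁ refl = inj₂ (profile-single z)
... | inj₂ p = inj₂ (profile-snoc w z p adj)

OddForm : Word → Set
OddForm W = Σ ℕ (λ b → (length W ≡ 2 * lpk W + b)
                       × (∀ l → oddFac l W ≡ pow4 (lpk W) * Y (lpk W) b (suc (length W)) l))

profile-oddForm : ∀ {W} → Profile W → OddForm W
profile-oddForm (endsUp v y j b _ _ hl hlen hodd _) rewrite hl = suc b , hlen , hodd
profile-oddForm (endsDown v y i b _ _ hl hlen hodd _) rewrite hl = b , hlen , hodd

oddForm : ∀ W → Linked _≢_ W → OddForm W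
oddForm W adj with profile (reverseView W) adj
... | inj₁ refl = 0 , refl , λ l → trans (oddFac-[] l) (sym (trans (+-identityʳ _) (Y-geom l)))
... | inj₂ p = profile-oddForm p

coeff : ℕ → ℕ → ℕ → ℕ
coeff n j l = pow4 j * Y j (n ∸ 2 * j) (suc n) l

oddFac-closed : ∀ W → Linked _≢_ W → ∀ l → oddFac l W ≡ coeff (length W) (lpk W) l
oddFac-closed W adj l with oddForm W adj
... | b , hlen , hodd =
  trans (hodd l) (cong (λ c → pow4 (lpk W) * Y (lpk W) c (suc (length W)) l)
                       (sym (trans (cong (_∸ 2 * lpk W) hlen) (m+n∸m≡n (2 * lpk W) b))))

lpk-bound : ∀ W → Linked _≢_ W → lpk W ≤ length W / 2
lpk-bound W adj with oddForm W adj
... | b , hlen , _ rewrite hlen =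
  subst (_≤ (2 * lpk W + b) / 2) (trans (cong (_/ 2) (*-comm 2 (lpk W))) (m*n/n≡m (lpk W) 2))
        (/-monoˡ-≤ 2 (m≤m+n (2 * lpk W) b))

-- coeff n j is a series starting at t^j with leading coefficient 4^j > 0:
-- the images of different lpk values are triangular with respect to t.
coeff-below : ∀ n j l → l < j → coeff n j l ≡ 0
coeff-below n j l l<j = trans (cong (pow4 j *_) (Y-below j (n ∸ 2 * j) (suc n) l l<j)) (*-zeroʳ (pow4 j))

coeff-lowest-pos : ∀ n j → 0 < coeff n j j
coeff-lowest-pos n j =
  subst (0 <_) (sym (trans (cong (pow4 j *_) (Y-lowest j (n ∸ 2 * j) (suc n))) (*-identityʳ (pow4 j))))
        (m^n>0 2 (2 * j))

ℕtoℚ≃ : ∀ n → toℚᵘ (ℕtoℚ n) ℚᵘ.≃ mkℚᵘ (ℤ.+ n) 0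
ℕtoℚ≃ n = ℚ.toℚᵘ-fromℚᵘ (mkℚᵘ (ℤ.+ n) 0)

ℕtoℚ-+ : ∀ a b → ℕtoℚ (a + b) ≡ ℕtoℚ a ℚ.+ ℕtoℚ b
ℕtoℚ-+ a b = ℚ.toℚᵘ-injective (ℚᵘ.≃-trans (ℕtoℚ≃ (a + b)) (ℚᵘ.≃-sym
  (ℚᵘ.≃-trans (ℚ.toℚᵘ-homo-+ (ℕtoℚ a) (ℕtoℚ b)) (ℚᵘ.≃-trans (ℚᵘ.+-cong (ℕtoℚ≃ a) (ℕtoℚ≃ b)) sum≃))))
  where
  sum≃ : (mkℚᵘ (ℤ.+ a) 0 ℚᵘ.+ mkℚᵘ (ℤ.+ b) 0) ℚᵘ.≃ mkℚᵘ (ℤ.+ (a + b)) 0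
  sum≃ = *≡* (trans (ℤ.*-identityʳ _) (trans (cong₂ ℤ._+_ (ℤ.*-identityʳ (ℤ.+ a)) (ℤ.*-identityʳ (ℤ.+ b)))
               (trans (sym (ℤ.pos-+ a b)) (sym (ℤ.*-identityʳ (ℤ.+ (a + b)))))))

ℕtoℚ-* : ∀ a b → ℕtoℚ (a * b) ≡ ℕtoℚ a ℚ.* ℕtoℚ b
ℕtoℚ-* a b = ℚ.toℚᵘ-injective (ℚᵘ.≃-trans (ℕtoℚ≃ (a * b)) (ℚᵘ.≃-sym
  (ℚᵘ.≃-trans (ℚ.toℚᵘ-homo-* (ℕtoℚ a) (ℕtoℚ b)) (ℚᵘ.≃-trans (ℚᵘ.*-cong (ℕtoℚ≃ a) (ℕtoℚ≃ b)) product≃))))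
  where
  product≃ : (mkℚᵘ (ℤ.+ a) 0 ℚᵘ.* mkℚᵘ (ℤ.+ b) 0) ℚᵘ.≃ mkℚᵘ (ℤ.+ (a * b)) 0
  product≃ = *≡* (trans (ℤ.*-identityʳ _) (trans (sym (ℤ.pos-* a b)) (sym (ℤ.*-identityʳ (ℤ.+ (a * b))))))

ℕtoℚ-zero : ∀ n → ℕtoℚ n ≡ 0ℚ → n ≡ 0
ℕtoℚ-zero n e with ℚᵘ.≃-trans (ℚᵘ.≃-sym (ℕtoℚ≃ n)) (ℚᵘ.≃-trans (ℚᵘ.≃-reflexive (cong toℚᵘ e)) (ℕtoℚ≃ 0))
... | *≡* eq = ℤ.+-injective (trans (sym (ℤ.*-identityʳ (ℤ.+ n))) (trans eq (ℤ.*-identityʳ (ℤ.+ 0))))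

ℕtoℚ-∑ : {A : Set} (xs : List A) (h : A → ℕ) → ℕtoℚ (∑ xs h) ≡ sumℚ (map (λ x → ℕtoℚ (h x)) xs)
ℕtoℚ-∑ [] h = refl
ℕtoℚ-∑ (x ∷ xs) h = trans (ℕtoℚ-+ (h x) (∑ xs h)) (cong (ℕtoℚ (h x) ℚ.+_) (ℕtoℚ-∑ xs h))

ℕtoℚ-guard : ∀ b x → (if b then ℕtoℚ x else 0ℚ) ≡ ℕtoℚ (guard b x)
ℕtoℚ-guard true x = refl
ℕtoℚ-guard false x = refl

record _≈ℚ_ (f : Seq) (F : Series) : Set where
  constructor coefficientwise
  field coefficient : ∀ i → ℕtoℚ (f i) ≡ F i
open _≈ℚ_

conv≈ : ∀ {f g F G} → f ≈ℚ F → g ≈ℚ G → conv f g ≈ℚ (F ·ₛ G)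
conv≈ {f} {g} ef eg = coefficientwise λ m → trans (ℕtoℚ-∑ (upTo (suc m)) (λ i → f i * g (m ∸ i)))
  (cong sumℚ (map-cong (λ i → trans (ℕtoℚ-* (f i) (g (m ∸ i)))
                                    (cong₂ ℚ._*_ (coefficient ef i) (coefficient eg (m ∸ i))))
                       (upTo (suc m))))

pow≈ : ∀ {f F} → f ≈ℚ F → ∀ k → powᴺ f k ≈ℚ (F ^ₛ k)
pow≈ ef zero = coefficientwise λ { zero → refl ; (suc i) → refl }
pow≈ ef (suc k) = conv≈ ef (pow≈ ef k)

t≈ : tᴺ ≈ℚ tₛ
t≈ = coefficientwise λ { zero → refl ; (suc zero) → refl ; (suc (suc i)) → refl }

onePlusT≈ : onePlusTᴺ ≈ℚ onePlusT
onePlusT≈ = coefficientwise λ { zero → refl ; (suc zero) → refl ; (suc (suc i)) → refl }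

geom≈ : geomᴺ ≈ℚ geom
geom≈ = coefficientwise λ i → refl

gSeries≈ : ∀ n j m → ℕtoℚ (coeff n j m) ≡ gSeries n j m
gSeries≈ n j m = trans (ℕtoℚ-* (pow4 j) (Y j (n ∸ 2 * j) (suc n) m))
  (cong (ℕtoℚ (pow4 j) ℚ.*_)
        (coefficient (conv≈ (pow≈ t≈ j) (conv≈ (pow≈ onePlusT≈ (n ∸ 2 * j)) (pow≈ geom≈ (suc n)))) m))

monomial-at : ∀ n c k m → monomial n c k m ≡ (if k ≡ᵇ n then c m else 0ℚ)
monomial-at n c k m with k ≡ᵇ n
... | true = refl
... | false = refl

φperm-coeff : ∀ p k m → φperm p k m ≡ ℕtoℚ (guard (k ≡ᵇ length p) (coeff (length p) (lpk p) m))
φperm-coeff [] zero m = cong ℕtoℚ (sym (trans (+-identityʳ _) (Y-geom m)))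
φperm-coeff [] (suc k) m = refl
φperm-coeff (x ∷ p) k m = trans (monomial-at n (gSeries n (lpk (x ∷ p))) k m)
  (trans (cong (λ c → if k ≡ᵇ n then c else 0ℚ) (sym (gSeries≈ n (lpk (x ∷ p)) m))) (ℕtoℚ-guard (k ≡ᵇ n) _))
  where n = suc (length p)

φperm-oddFac : ∀ p → Linked _≢_ p → ∀ k m → φperm p k m ≡ ℕtoℚ (guard (k ≡ᵇ length p) (oddFac m p))
φperm-oddFac p adj k m =
  trans (φperm-coeff p k m) (cong (λ c → ℕtoℚ (guard (k ≡ᵇ length p) c)) (sym (oddFac-closed p adj m)))

IsPerm⇒Linked : ∀ {π} → IsPerm π → Linked _≢_ π
IsPerm⇒Linked pπ = AllPairs⇒Linked (proj₁ pπ)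

length-shuffle : ∀ α β τ → τ ∈ shuffles α β → length τ ≡ length α + length β
length-shuffle [] β τ (here refl) = refl
length-shuffle (x ∷ xs) [] τ (here refl) = cong suc (sym (+-identityʳ _))
length-shuffle (x ∷ xs) (y ∷ ys) τ τ∈ with ∈-++⁻ (map (x ∷_) (shuffles xs (y ∷ ys))) τ∈
... | inj₁ τ∈x with ∈-map⁻ _ τ∈x
...   | (s , s∈ , refl) = cong suc (length-shuffle xs (y ∷ ys) s s∈)
length-shuffle (x ∷ xs) (y ∷ ys) τ τ∈ | inj₂ τ∈y with ∈-map⁻ _ τ∈y
...   | (s , s∈ , refl) =
  trans (cong suc (length-shuffle (x ∷ xs) ys s s∈)) (sym (+-suc (suc (length xs)) (length ys)))

letter-shuffle : ∀ α β τ z → τ ∈ shuffles α β → z ∈ τ → z ∈ α ⊎ z ∈ β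
letter-shuffle [] β τ z (here refl) z∈ = inj₂ z∈
letter-shuffle (x ∷ xs) [] τ z (here refl) z∈ = inj₁ z∈
letter-shuffle (x ∷ xs) (y ∷ ys) τ z τ∈ z∈ with ∈-++⁻ (map (x ∷_) (shuffles xs (y ∷ ys))) τ∈
... | inj₁ τ∈x with ∈-map⁻ _ τ∈x
...   | (s , s∈ , refl) with z∈
...     | here z≡x = inj₁ (here z≡x)
...     | there z∈s with letter-shuffle xs (y ∷ ys) s z s∈ z∈s
...       | inj₁ z∈xs = inj₁ (there z∈xs)
...       | inj₂ z∈β = inj₂ z∈β
letter-shuffle (x ∷ xs) (y ∷ ys) τ z τ∈ z∈ | inj₂ τ∈y with ∈-map⁻ _ τ∈y
...   | (s , s∈ , refl) with z∈
...     | here z≡y = inj₂ (here z≡y)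
...     | there z∈s with letter-shuffle (x ∷ xs) ys s z s∈ z∈s
...       | inj₁ z∈α = inj₁ z∈α
...       | inj₂ z∈ys = inj₂ (there z∈ys)

unique-shuffle : ∀ α β → Unique α → Unique β → Disjoint α β → ∀ τ → τ ∈ shuffles α β → Unique τ
unique-shuffle [] β uα uβ d τ (here refl) = uβ
unique-shuffle (x ∷ xs) [] uα uβ d τ (here refl) = uα
unique-shuffle (x ∷ xs) (y ∷ ys) (x∉xs ∷ uxs) uβ d τ τ∈ with ∈-++⁻ (map (x ∷_) (shuffles xs (y ∷ ys))) τ∈
... | inj₁ τ∈x with ∈-map⁻ _ τ∈x
...   | (s , s∈ , refl) = All.tabulate x∉s ∷ unique-shuffle xs (y ∷ ys) uxs uβ (Disjoint-tailˡ d) s s∈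
  where
  x∉s : ∀ {z} → z ∈ s → x ≢ z
  x∉s z∈s refl with letter-shuffle xs (y ∷ ys) s x s∈ z∈s
  ... | inj₁ x∈xs = All.lookup x∉xs x∈xs refl
  ... | inj₂ x∈β = d (here refl) x∈β
unique-shuffle (x ∷ xs) (y ∷ ys) uα (y∉ys ∷ uys) d τ τ∈ | inj₂ τ∈y with ∈-map⁻ _ τ∈y
...   | (s , s∈ , refl) = All.tabulate y∉s ∷ unique-shuffle (x ∷ xs) ys uα uys (Disjoint-tailʳ d) s s∈
  where
  y∉s : ∀ {z} → z ∈ s → y ≢ z
  y∉s z∈s refl with letter-shuffle (x ∷ xs) ys s y s∈ z∈s
  ... | inj₁ y∈α = d y∈α (here refl)
  ... | inj₂ y∈ys = All.lookup y∉ys y∈ys refl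

≡ᵇ-refl : ∀ n → (n ≡ᵇ n) ≡ true
≡ᵇ-refl zero = refl
≡ᵇ-refl (suc n) = ≡ᵇ-refl n

≢⇒≡ᵇ-false : ∀ m n → m ≢ n → (m ≡ᵇ n) ≡ false
≢⇒≡ᵇ-false zero zero m≢n = ⊥-elim (m≢n refl)
≢⇒≡ᵇ-false zero (suc n) _ = refl
≢⇒≡ᵇ-false (suc m) zero _ = refl
≢⇒≡ᵇ-false (suc m) (suc n) m≢n = ≢⇒≡ᵇ-false m n (m≢n ∘ cong suc)

<⇒<ᵇ-true : ∀ m n → m < n → (m <ᵇ n) ≡ true
<⇒<ᵇ-true zero (suc n) _ = refl
<⇒<ᵇ-true (suc m) (suc n) (s≤s m<n) = <⇒<ᵇ-true m n m<n

≥⇒<ᵇ-false : ∀ m n → n ≤ m → (m <ᵇ n) ≡ false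
≥⇒<ᵇ-false m zero _ = refl
≥⇒<ᵇ-false (suc m) (suc n) (s≤s n≤m) = ≥⇒<ᵇ-false m n n≤m

∑-indicator : ∀ N A (h : ℕ → ℕ) → ∑ (upTo N) (λ a → guard (a ≡ᵇ A) (h a)) ≡ guard (A <ᵇ N) (h A)
∑-indicator zero A h = refl
∑-indicator (suc N) A h =
  trans (∑-upTo-last N _) (trans (cong (_+ guard (N ≡ᵇ A) (h N)) (∑-indicator N A h)) (lastTerm (<-cmp A N)))
  where
  lastTerm : _ → guard (A <ᵇ N) (h A) + guard (N ≡ᵇ A) (h N) ≡ guard (A <ᵇ suc N) (h A)
  lastTerm (tri< A<N _ _)
    rewrite <⇒<ᵇ-true A N A<N | ≢⇒≡ᵇ-false N A (λ e → <-irrefl (sym e) A<N)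
          | <⇒<ᵇ-true A (suc N) (m<n⇒m<1+n A<N) = +-identityʳ _
  lastTerm (tri≈ _ refl _) rewrite ≥⇒<ᵇ-false A A ≤-refl | ≡ᵇ-refl A | <⇒<ᵇ-true A (suc A) ≤-refl = refl
  lastTerm (tri> _ _ N<A)
    rewrite ≥⇒<ᵇ-false A N (<⇒≤ N<A) | ≢⇒≡ᵇ-false N A (λ e → <-irrefl e N<A) | ≥⇒<ᵇ-false A (suc N) N<A = refl

∑-monomial-product : ∀ n A B c d →
  ∑ (upTo (suc n)) (λ a → guard (a ≡ᵇ A) c * guard (n ∸ a ≡ᵇ B) d) ≡ guard (n ≡ᵇ A + B) (c * d)
∑-monomial-product n A B c d =
  trans (∑-cong (upTo (suc n)) (λ a → guard-* (a ≡ᵇ A) c _))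
        (trans (∑-indicator (suc n) A (λ a → c * guard (n ∸ a ≡ᵇ B) d)) (degrees (A ≤? n)))
  where
  open import Data.Nat using (_≤?_)
  guard-* : ∀ b m n → guard b m * n ≡ guard b (m * n)
  guard-* true m n = refl
  guard-* false m n = refl
  *-guard : ∀ b m n → m * guard b n ≡ guard b (m * n)
  *-guard true m n = refl
  *-guard false m n = *-zeroʳ m
  ∸≡ᵇ : ∀ n A B → A ≤ n → (n ∸ A ≡ᵇ B) ≡ (n ≡ᵇ A + B)
  ∸≡ᵇ n zero B _ = refl
  ∸≡ᵇ (suc n) (suc A) B (s≤s A≤n) = ∸≡ᵇ n A B A≤n
  ≡ᵇ-false : ∀ n A B → n < A → (n ≡ᵇ A + B) ≡ false
  ≡ᵇ-false zero (suc A) B _ = refl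
  ≡ᵇ-false (suc n) (suc A) B (s≤s n<A) = ≡ᵇ-false n A B n<A
  degrees : _ → guard (A <ᵇ suc n) (c * guard (n ∸ A ≡ᵇ B) d) ≡ guard (n ≡ᵇ A + B) (c * d)
  degrees (yes A≤n) rewrite <⇒<ᵇ-true A (suc n) (s≤s A≤n) | ∸≡ᵇ n A B A≤n = *-guard (n ≡ᵇ A + B) c d
  degrees (no A≰n) rewrite ≥⇒<ᵇ-false A (suc n) (≰⇒> A≰n) | ≡ᵇ-false n A B (≰⇒> A≰n) = refl

sumₚ-at : {A : Set} (F : A → Poly) (xs : List A) → ∀ n m → sumₚ (map F xs) n m ≡ sumℚ (map (λ x → F x n m) xs)
sumₚ-at F [] n m = refl
sumₚ-at F (x ∷ xs) n m = cong (F x n m ℚ.+_) (sumₚ-at F xs n m)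

sumℚ-cong∈ : {A : Set} (xs : List A) (f g : A → ℚ) → (∀ x → x ∈ xs → f x ≡ g x) → sumℚ (map f xs) ≡ sumℚ (map g xs)
sumℚ-cong∈ [] f g e = refl
sumℚ-cong∈ (x ∷ xs) f g e = cong₂ ℚ._+_ (e x (here refl)) (sumℚ-cong∈ xs f g (λ y y∈ → e y (there y∈)))

shuffle-linked : ∀ {π σ} → IsPerm π → IsPerm σ → Disjoint π σ → ∀ {τ} → τ ∈ shuffles π σ → Linked _≢_ τ
shuffle-linked {π} {σ} pπ pσ d {τ} τ∈ = AllPairs⇒Linked (unique-shuffle π σ (proj₁ pπ) (proj₁ pσ) d τ τ∈)

-- (b1): coefficientwise, both sides are the image of
-- guard (n = |π| + |σ|) (oddFac m π · oddFac m σ), using the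
-- shuffle-multiplicativity of oddFac m on the right.
φperm-multiplicative : ∀ π σ → IsPerm π → IsPerm σ → Disjoint π σ
  → (φperm π ·ₚ φperm σ) ≋ sumₚ (map φperm (shuffles π σ))
φperm-multiplicative π σ pπ pσ d n m = trans product (sym shuffled)
  where
  open ≡-Reasoning
  A = length π
  B = length σ
  product : (φperm π ·ₚ φperm σ) n m ≡ ℕtoℚ (guard (n ≡ᵇ A + B) (oddFac m π * oddFac m σ))
  product = begin
    sumℚ (map (λ a → φperm π a m ℚ.* φperm σ (n ∸ a) m) (upTo (suc n)))
      ≡⟨ cong sumℚ (map-cong (λ a → trans (cong₂ ℚ._*_ (φperm-oddFac π (IsPerm⇒Linked pπ) a m)
                                                          (φperm-oddFac σ (IsPerm⇒Linked pσ) (n ∸ a) m))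
                                            (sym (ℕtoℚ-* (guard (a ≡ᵇ A) (oddFac m π))
                                                         (guard (n ∸ a ≡ᵇ B) (oddFac m σ)))))
                             (upTo (suc n))) ⟩
    sumℚ (map (λ a → ℕtoℚ (guard (a ≡ᵇ A) (oddFac m π) * guard (n ∸ a ≡ᵇ B) (oddFac m σ))) (upTo (suc n)))
      ≡⟨ sym (ℕtoℚ-∑ (upTo (suc n)) (λ a → guard (a ≡ᵇ A) (oddFac m π) * guard (n ∸ a ≡ᵇ B) (oddFac m σ))) ⟩
    ℕtoℚ (∑ (upTo (suc n)) (λ a → guard (a ≡ᵇ A) (oddFac m π) * guard (n ∸ a ≡ᵇ B) (oddFac m σ)))
      ≡⟨ cong ℕtoℚ (∑-monomial-product n A B (oddFac m π) (oddFac m σ)) ⟩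
    ℕtoℚ (guard (n ≡ᵇ A + B) (oddFac m π * oddFac m σ)) ∎
  shuffled : sumₚ (map φperm (shuffles π σ)) n m ≡ ℕtoℚ (guard (n ≡ᵇ A + B) (oddFac m π * oddFac m σ))
  shuffled = begin
    sumₚ (map φperm (shuffles π σ)) n m
      ≡⟨ sumₚ-at φperm (shuffles π σ) n m ⟩
    sumℚ (map (λ τ → φperm τ n m) (shuffles π σ))
      ≡⟨ sumℚ-cong∈ (shuffles π σ) _ _ (λ τ τ∈ → φperm-oddFac τ (shuffle-linked pπ pσ d τ∈) n m) ⟩
    sumℚ (map (λ τ → ℕtoℚ (guard (n ≡ᵇ length τ) (oddFac m τ))) (shuffles π σ))
      ≡⟨ sym (ℕtoℚ-∑ (shuffles π σ) (λ τ → guard (n ≡ᵇ length τ) (oddFac m τ))) ⟩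
    ℕtoℚ (∑ (shuffles π σ) (λ τ → guard (n ≡ᵇ length τ) (oddFac m τ)))
      ≡⟨ cong ℕtoℚ (∑-cong∈ (shuffles π σ) (λ τ τ∈ → cong (λ k → guard (n ≡ᵇ k) (oddFac m τ))
                                                           (length-shuffle π σ τ τ∈))) ⟩
    ℕtoℚ (∑ (shuffles π σ) (λ τ → guard (n ≡ᵇ A + B) (oddFac m τ)))
      ≡⟨ cong ℕtoℚ (∑-guard (shuffles π σ) (n ≡ᵇ A + B) (oddFac m)) ⟩
    ℕtoℚ (guard (n ≡ᵇ A + B) (shuffleSum (oddFac m) π σ))
      ≡⟨ cong (λ k → ℕtoℚ (guard (n ≡ᵇ A + B) k)) (oddFac-multiplicative m π σ d) ⟩
    ℕtoℚ (guard (n ≡ᵇ A + B) (oddFac m π * oddFac m σ)) ∎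

coeff-shuffles : ∀ π σ → IsPerm π → IsPerm σ → Disjoint π σ → ∀ l →
  ∑ (map lpk (shuffles π σ)) (λ j → coeff (length π + length σ) j l)
  ≡ coeff (length π) (lpk π) l * coeff (length σ) (lpk σ) l
coeff-shuffles π σ pπ pσ d l = begin
  ∑ (map lpk (shuffles π σ)) (λ j → coeff (length π + length σ) j l)
    ≡⟨ ∑-map lpk (shuffles π σ) _ ⟩
  ∑ (shuffles π σ) (λ τ → coeff (length π + length σ) (lpk τ) l)
    ≡⟨ ∑-cong∈ (shuffles π σ) (λ τ τ∈ → trans (cong (λ k → coeff k (lpk τ) l) (sym (length-shuffle π σ τ τ∈)))
                                              (sym (oddFac-closed τ (shuffle-linked pπ pσ d τ∈) l))) ⟩
  shuffleSum (oddFac l) π σ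
    ≡⟨ oddFac-multiplicative l π σ d ⟩
  oddFac l π * oddFac l σ
    ≡⟨ cong₂ _*_ (oddFac-closed π (IsPerm⇒Linked pπ) l) (oddFac-closed σ (IsPerm⇒Linked pσ) l) ⟩
  coeff (length π) (lpk π) l * coeff (length σ) (lpk σ) l ∎
  where open ≡-Reasoning

∑-member-≤ : {A : Set} (xs : List A) (f : A → ℕ) {x : A} → x ∈ xs → f x ≤ ∑ xs f
∑-member-≤ (y ∷ xs) f (here refl) = m≤m+n (f y) _
∑-member-≤ (y ∷ xs) f (there x∈) = ≤-trans (∑-member-≤ xs f x∈) (m≤n+m _ (f y))

minimum : ∀ x xs → Σ ℕ (λ m → m ∈ (x ∷ xs) × All (m ≤_) (x ∷ xs))
minimum x [] = x , here refl , (≤-refl ∷ [])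
minimum x (y ∷ ys) with minimum y ys
... | (m , m∈ , m≤) with m ≤? x
...   | yes m≤x = m , there m∈ , (m≤x ∷ m≤)
...   | no m≰x = x , here refl , (≤-refl ∷ All.map (≤-trans (<⇒≤ (≰⇒> m≰x))) m≤)

-- A triangular family of sequences (G l j = 0 for l < j and G j j > 0)
-- determines multisets of indices: the sums Σ_{j ∈ L} G l j for all l fix L
-- up to reordering.  Its least element m is detected at l = m, removed from
-- both sides, and the rest follows by induction.
module Triangular (G : ℕ → ℕ → ℕ) (G-below : ∀ l j → l < j → G l j ≡ 0) (G-diag : ∀ j → 0 < G j j) where

  S : List ℕ → ℕ → ℕ
  S L l = ∑ L (G l)

  S-pos : ∀ L m → m ∈ L → 0 < S L m
  S-pos L m m∈ = <-≤-trans (G-diag m) (∑-member-≤ L (G m) m∈)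

  S-zero : ∀ L m → All (m ≤_) L → m ∉ L → S L m ≡ 0
  S-zero L m m≤ m∉ = ∑-zero L (λ j j∈ → G-below m j (≤∧≢⇒< (All.lookup m≤ j∈) (λ e → m∉ (subst (_∈ L) (sym e) j∈))))

  transfer : ∀ L L′ m → All (m ≤_) L′ → m ∈ L → S L m ≡ S L′ m → m ∈ L′
  transfer L L′ m m≤ m∈ e with m ∈? L′
  ... | yes m∈′ = m∈′
  ... | no m∉′ = ⊥-elim (<-irrefl (sym (trans e (S-zero L′ m m≤ m∉′))) (S-pos L m m∈))

  S-remove : ∀ L₁ m L₂ l → S (L₁ ++ [ m ] ++ L₂) l ≡ G l m + S (L₁ ++ L₂) l
  S-remove L₁ m L₂ l = trans (∑-++ L₁ (m ∷ L₂) (G l))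
    (trans (x∙yz≈y∙xz (S L₁ l) (G l m) (S L₂ l)) (cong (G l m +_) (sym (∑-++ L₁ L₂ (G l)))))

  determines : ∀ L L′ → (∀ l → S L l ≡ S L′ l) → L ↭ L′
  determines K K′ = go (length K) K K′ ≤-refl
    where
    go : ∀ n L L′ → length L ≤ n → (∀ l → S L l ≡ S L′ l) → L ↭ L′
    go n [] [] _ e = ↭-refl
    go n [] (y ∷ ys) _ e = ⊥-elim (<-irrefl (e y) (S-pos (y ∷ ys) y (here refl)))
    go (suc n) (x ∷ xs) L′ len e with minimum x (xs ++ L′)
    ... | (m , m∈ , m≤) =
      ↭-trans (subst (_↭ m ∷ (L₁ ++ L₂)) (sym eqL) (↭-shift m L₁ L₂))
        (↭-trans (prep m (go n (L₁ ++ L₂) (L₁′ ++ L₂′) shorter rest))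
                 (↭-sym (subst (_↭ m ∷ (L₁′ ++ L₂′)) (sym eqL′) (↭-shift m L₁′ L₂′))))
      where
      L = x ∷ xs
      inBoth : m ∈ L × m ∈ L′
      inBoth with ∈-++⁻ L m∈
      ... | inj₁ m∈L = m∈L , transfer L L′ m (All.++⁻ʳ L m≤) m∈L (e m)
      ... | inj₂ m∈L′ = transfer L′ L m (All.++⁻ˡ L m≤) m∈L′ (sym (e m)) , m∈L′
      L₁ = proj₁ (∈-∃++ (proj₁ inBoth))
      L₂ = proj₁ (proj₂ (∈-∃++ (proj₁ inBoth)))
      eqL : L ≡ L₁ ++ [ m ] ++ L₂
      eqL = proj₂ (proj₂ (∈-∃++ (proj₁ inBoth)))
      L₁′ = proj₁ (∈-∃++ (proj₂ inBoth))
      L₂′ = proj₁ (proj₂ (∈-∃++ (proj₂ inBoth)))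
      eqL′ : L′ ≡ L₁′ ++ [ m ] ++ L₂′
      eqL′ = proj₂ (proj₂ (∈-∃++ (proj₂ inBoth)))
      rest : ∀ l → S (L₁ ++ L₂) l ≡ S (L₁′ ++ L₂′) l
      rest l = +-cancelˡ-≡ (G l m) _ _ (begin
        G l m + S (L₁ ++ L₂) l       ≡⟨ sym (S-remove L₁ m L₂ l) ⟩
        S (L₁ ++ [ m ] ++ L₂) l      ≡⟨ cong (λ K → S K l) (sym eqL) ⟩
        S L l                        ≡⟨ e l ⟩
        S L′ l                       ≡⟨ cong (λ K → S K l) eqL′ ⟩
        S (L₁′ ++ [ m ] ++ L₂′) l    ≡⟨ S-remove L₁′ m L₂′ l ⟩
        G l m + S (L₁′ ++ L₂′) l     ∎)
        where open ≡-Reasoning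
      shorter : length (L₁ ++ L₂) ≤ n
      shorter = ≤-pred (subst (_≤ suc n) lengthL len)
        where
        lengthL : length L ≡ suc (length (L₁ ++ L₂))
        lengthL = trans (cong length eqL) (trans (length-++ L₁)
                    (trans (+-suc (length L₁) (length L₂)) (cong suc (sym (length-++ L₁)))))

-- (a): by coeff-shuffles, the multisets of lpk values of the shuffles of
-- (π, σ) and of (π′, σ′) have the same sums against the triangular family
-- coeff N, so they coincide.
lpk-shuffle-compatible : ∀ π σ π′ σ′ → IsPerm π → IsPerm σ → IsPerm π′ → IsPerm σ′
  → Disjoint π σ → Disjoint π′ σ′ → π ∼lpk π′ → σ ∼lpk σ′
  → map lpk (shuffles π σ) ↭ map lpk (shuffles π′ σ′)
lpk-shuffle-compatible π σ π′ σ′ pπ pσ pπ′ pσ′ d d′ (|π|≡ , lpkπ≡) (|σ|≡ , lpkσ≡) =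
  T.determines (map lpk (shuffles π σ)) (map lpk (shuffles π′ σ′)) λ l → begin
    ∑ (map lpk (shuffles π σ)) (λ j → coeff N j l)
      ≡⟨ coeff-shuffles π σ pπ pσ d l ⟩
    coeff (length π) (lpk π) l * coeff (length σ) (lpk σ) l
      ≡⟨ cong₂ _*_ (cong₂ (λ n j → coeff n j l) |π|≡ lpkπ≡) (cong₂ (λ n j → coeff n j l) |σ|≡ lpkσ≡) ⟩
    coeff (length π′) (lpk π′) l * coeff (length σ′) (lpk σ′) l
      ≡⟨ sym (coeff-shuffles π′ σ′ pπ′ pσ′ d′ l) ⟩
    ∑ (map lpk (shuffles π′ σ′)) (λ j → coeff (length π′ + length σ′) j l)
      ≡⟨ cong (λ n → ∑ (map lpk (shuffles π′ σ′)) (λ j → coeff n j l)) (sym (cong₂ _+_ |π|≡ |σ|≡)) ⟩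
    ∑ (map lpk (shuffles π′ σ′)) (λ j → coeff N j l) ∎
  where
  open ≡-Reasoning
  N = length π + length σ
  module T = Triangular (λ l j → coeff N j l) (λ l j → coeff-below N j l) (coeff-lowest-pos N)

cancel-nonzero : ∀ c k → c ℚ.* k ≡ 0ℚ → k ≢ 0ℚ → c ≡ 0ℚ
cancel-nonzero c k ck≡0 k≢0 = begin
  c                           ≡⟨ sym (ℚ.*-identityʳ c) ⟩
  c ℚ.* 1ℚ                    ≡⟨ cong (c ℚ.*_) (sym (ℚ.*-inverseʳ k)) ⟩
  c ℚ.* (k ℚ.* ℚ.1/ k)        ≡⟨ sym (ℚ.*-assoc c k (ℚ.1/ k)) ⟩
  (c ℚ.* k) ℚ.* ℚ.1/ k        ≡⟨ cong (ℚ._* ℚ.1/ k) ck≡0 ⟩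
  0ℚ ℚ.* ℚ.1/ k               ≡⟨ ℚ.*-zeroˡ (ℚ.1/ k) ⟩
  0ℚ                          ∎
  where
  open ≡-Reasoning
  instance
    _ : ℚ.NonZero k
    _ = ℚ.≢-nonZero k≢0

sumℚ-zero : {A : Set} (f : A → ℚ) (xs : List A) → (∀ p → p ∈ xs → f p ≡ 0ℚ) → sumℚ (map f xs) ≡ 0ℚ
sumℚ-zero f [] h = refl
sumℚ-zero f (x ∷ xs) h =
  trans (cong₂ ℚ._+_ (h x (here refl)) (sumℚ-zero f xs (λ p p∈ → h p (there p∈)))) (ℚ.+-identityʳ 0ℚ)

sumℚ-single : {A : Set} {R : A → A → Set} (f : A → ℚ) (xs : List A) {q : A} → q ∈ xs → AllPairs R xs
  → (∀ p → p ∈ xs → (R q p ⊎ R p q) → f p ≡ 0ℚ) → sumℚ (map f xs) ≡ f q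
sumℚ-single f (x ∷ xs) (here refl) (x~xs ∷ _) h =
  trans (cong (f x ℚ.+_) (sumℚ-zero f xs (λ p p∈ → h p (there p∈) (inj₁ (All.lookup x~xs p∈)))))
        (ℚ.+-identityʳ (f x))
sumℚ-single f (x ∷ xs) (there q∈) (x~xs ∷ rs) h =
  trans (cong (ℚ._+ sumℚ (map f xs)) (h x (here refl) (inj₂ (All.lookup x~xs q∈))))
        (trans (ℚ.+-identityˡ _) (sumℚ-single f xs q∈ rs (λ p p∈ → h p (there p∈))))

guarded-term-zero : ∀ c b x → (b ≡ false ⊎ x ≡ 0 ⊎ c ≡ 0ℚ) → c ℚ.* ℕtoℚ (guard b x) ≡ 0ℚ
guarded-term-zero c .false x (inj₁ refl) = ℚ.*-zeroʳ c
guarded-term-zero c b .0 (inj₂ (inj₁ refl)) = trans (cong (λ t → c ℚ.* ℕtoℚ t) (guard-0 b)) (ℚ.*-zeroʳ c)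
guarded-term-zero .0ℚ b x (inj₂ (inj₂ refl)) = ℚ.*-zeroˡ (ℕtoℚ (guard b x))

-- (b2): if a combination of images of pairwise inequivalent words vanishes,
-- each coefficient c_q vanishes, by strong induction on j = lpk q: at x^n t^j
-- (n the length of q) the only surviving term is c_q · 4^j, since terms of
-- larger lpk start at a higher power of t and those of smaller lpk have zero
-- coefficient by induction.
φperm-independent : ∀ (cs : List (List ℕ × ℚ))
  → AllPairs (λ p q → ¬ (proj₁ p ∼lpk proj₁ q)) cs
  → sumₚ (map (λ p → scaleₚ (proj₂ p) (φperm (proj₁ p))) cs) ≋ zeroₚ
  → All (λ p → proj₂ p ≡ 0ℚ) cs
φperm-independent cs inequivalent combination≡0 =
  All.tabulate (λ {q} q∈ → <-rec Vanishes step (lpk (proj₁ q)) q∈ refl)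
  where
  Vanishes : ℕ → Set
  Vanishes j = ∀ {q} → q ∈ cs → lpk (proj₁ q) ≡ j → proj₂ q ≡ 0ℚ
  term : ℕ → ℕ → List ℕ × ℚ → ℚ
  term n m p = proj₂ p ℚ.* φperm (proj₁ p) n m
  terms≡0 : ∀ n m → sumℚ (map (term n m) cs) ≡ 0ℚ
  terms≡0 n m = trans (sym (sumₚ-at (λ p → scaleₚ (proj₂ p) (φperm (proj₁ p))) cs n m)) (combination≡0 n m)
  step : ∀ j → (∀ {i} → i < j → Vanishes i) → Vanishes j
  step j smaller {q} q∈ lpk≡j = cancel-nonzero (proj₂ q) (ℕtoℚ (coeff n j j)) leading≡0 leading≢0
    where
    n = length (proj₁ q)
    leading≢0 : ℕtoℚ (coeff n j j) ≢ 0ℚ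
    leading≢0 e = <-irrefl (sym (ℕtoℚ-zero _ e)) (coeff-lowest-pos n j)
    other≡0 : ∀ p → p ∈ cs → ¬ (proj₁ q ∼lpk proj₁ p) → term n j p ≡ 0ℚ
    other≡0 p p∈ q≁p = trans (cong (proj₂ p ℚ.*_) (φperm-coeff (proj₁ p) n j))
      (guarded-term-zero (proj₂ p) _ _ (compare (n ≟ length (proj₁ p))))
      where
      compare : _ → ((n ≡ᵇ length (proj₁ p)) ≡ false
                     ⊎ coeff (length (proj₁ p)) (lpk (proj₁ p)) j ≡ 0 ⊎ proj₂ p ≡ 0ℚ)
      compare (no n≢) = inj₁ (≢⇒≡ᵇ-false n _ n≢)
      compare (yes n≡) with <-cmp (lpk (proj₁ p)) j
      ... | tri< i<j _ _ = inj₂ (inj₂ (smaller i<j p∈ refl))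
      ... | tri≈ _ i≡j _ = ⊥-elim (q≁p (n≡ , trans lpk≡j (sym i≡j)))
      ... | tri> _ _ j<i = inj₂ (inj₁ (coeff-below (length (proj₁ p)) (lpk (proj₁ p)) j j<i))
    term-q : term n j q ≡ proj₂ q ℚ.* ℕtoℚ (coeff n j j)
    term-q = trans (cong (proj₂ q ℚ.*_) (φperm-coeff (proj₁ q) n j))
      (cong₂ (λ b i → proj₂ q ℚ.* ℕtoℚ (guard b (coeff n i j))) (≡ᵇ-refl n) lpk≡j)
    leading≡0 : proj₂ q ℚ.* ℕtoℚ (coeff n j j) ≡ 0ℚ
    leading≡0 = trans (sym term-q) (trans (sym (sumℚ-single (term n j) cs q∈ inequivalent
      (λ p p∈ related → other≡0 p p∈ (λ q∼p → [ (λ r → r q∼p) , (λ r → r (sym (proj₁ q∼p) , sym (proj₂ q∼p))) ]′ related))))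
      (terms≡0 n j))

-- Witnesses for (b4): ascending k m = k, k+1, …, k+m-1 has no left peak, and
-- zigzag j m = 2 1 4 3 … 2j (2j-1) followed by an ascending run of length m
-- has exactly j of them.
ascending : ℕ → ℕ → List ℕ
ascending k zero = []
ascending k (suc m) = k ∷ ascending (suc k) m

+2 : ℕ → ℕ
+2 a = suc (suc a)

zigzag : ℕ → ℕ → List ℕ
zigzag zero m = ascending 1 m
zigzag (suc j) m = 2 ∷ 1 ∷ map +2 (zigzag j m)

n+1<ᵇn : ∀ k → (suc k <ᵇ k) ≡ false
n+1<ᵇn zero = refl
n+1<ᵇn (suc k) = n+1<ᵇn k

peaks-ascending : ∀ k m → peaks (ascending k m) ≡ 0
peaks-ascending k zero = refl
peaks-ascending k (suc zero) = refl
peaks-ascending k (suc (suc zero)) = refl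
peaks-ascending k (suc (suc (suc m))) =
  trans (cong (λ b → (if b then 1 else 0) + peaks (ascending (suc k) (suc (suc m))))
              (trans (cong ((k <ᵇ suc k) ∧_) (n+1<ᵇn k)) (∧-false (k <ᵇ suc k))))
        (peaks-ascending (suc k) (suc (suc m)))

lpk-ascending : ∀ k m → lpk (ascending k m) ≡ 0
lpk-ascending k zero = refl
lpk-ascending k (suc zero) = refl
lpk-ascending k (suc (suc m)) rewrite n+1<ᵇn k = peaks-ascending k (suc (suc m))

peaks-+2 : ∀ w → peaks (map +2 w) ≡ peaks w
peaks-+2 [] = refl
peaks-+2 (a ∷ []) = refl
peaks-+2 (a ∷ b ∷ []) = refl
peaks-+2 (a ∷ b ∷ c ∷ r) = cong (λ t → (if (a <ᵇ b) ∧ (c <ᵇ b) then 1 else 0) + t) (peaks-+2 (b ∷ c ∷ r))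

lpk-zigzag-step : ∀ w → lpk (2 ∷ 1 ∷ map +2 w) ≡ suc (lpk w)
lpk-zigzag-step [] = refl
lpk-zigzag-step (a ∷ []) = refl
lpk-zigzag-step (a ∷ b ∷ w) = cong (λ t → suc ((if b <ᵇ a then 1 else 0) + t)) (peaks-+2 (a ∷ b ∷ w))

lpk-zigzag : ∀ j m → lpk (zigzag j m) ≡ j
lpk-zigzag zero m = lpk-ascending 1 m
lpk-zigzag (suc j) m = trans (lpk-zigzag-step (zigzag j m)) (cong suc (lpk-zigzag j m))

length-zigzag : ∀ j m → length (zigzag j m) ≡ 2 * j + m
length-zigzag zero m = length-ascending 1 m
  where
  length-ascending : ∀ k m → length (ascending k m) ≡ m
  length-ascending k zero = refl
  length-ascending k (suc m) = cong suc (length-ascending (suc k) m)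
length-zigzag (suc j) m =
  trans (cong (λ t → suc (suc t)) (trans (length-map +2 (zigzag j m)) (length-zigzag j m))) (arith j m)
  where
  arith : ∀ j m → suc (suc (2 * j + m)) ≡ 2 * suc j + m
  arith = solve-∀

ascending-≥ : ∀ k m → All (k ≤_) (ascending k m)
ascending-≥ k zero = []
ascending-≥ k (suc m) = ≤-refl ∷ All.map (≤-trans (n≤1+n k)) (ascending-≥ (suc k) m)

ascending-unique : ∀ k m → Unique (ascending k m)
ascending-unique k zero = []
ascending-unique k (suc m) = All.map (λ k<a k≡a → <-irrefl k≡a k<a) (ascending-≥ (suc k) m) ∷ ascending-unique (suc k) m

zigzag-perm : ∀ j m → IsPerm (zigzag j m)
zigzag-perm zero m = ascending-unique 1 m , ascending-≥ 1 m
zigzag-perm (suc j) m with zigzag-perm j m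
... | (unique , positive) =
  ((λ ()) ∷ All.tabulate 2∉) ∷ (All.tabulate 1∉ ∷ map⁺ +2-injective unique)
  , (s≤s z≤n ∷ s≤s z≤n ∷ All.map⁺ (All.map (λ _ → s≤s z≤n) positive))
  where
  +2-injective : ∀ {x y} → +2 x ≡ +2 y → x ≡ y
  +2-injective refl = refl
  1∉ : ∀ {x} → x ∈ map +2 (zigzag j m) → 1 ≢ x
  1∉ x∈ 1≡x with ∈-map⁻ +2 x∈
  ... | (a , _ , refl) with 1≡x
  ... | ()
  2∉ : ∀ {x} → x ∈ map +2 (zigzag j m) → 2 ≢ x
  2∉ x∈ 2≡x with ∈-map⁻ +2 x∈
  ... | (a , a∈ , refl) with All.lookup positive a∈
  ... | a≥1 rewrite suc-injective (suc-injective (sym 2≡x)) with a≥1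
  ... | ()

achieves : ∀ n j → j ≤ n / 2 → Achieves n j
achieves n j j≤n/2 =
  zigzag j (n ∸ 2 * j) , zigzag-perm j (n ∸ 2 * j)
  , trans (length-zigzag j (n ∸ 2 * j)) (m+[n∸m]≡n 2j≤n) , lpk-zigzag j (n ∸ 2 * j)
  where
  2j≤n : 2 * j ≤ n
  2j≤n = ≤-trans (*-monoʳ-≤ 2 j≤n/2) (subst (_≤ n) (*-comm (n / 2) 2) (m/n*n≤m n 2))

degree-classes : ∀ n → Σ (List ℕ) (λ L → Unique L × (length L ≡ n / 2 + 1) × (∀ k → (k ∈ L) ⇔ Achieves n k))
degree-classes n = upTo (n / 2 + 1) , upTo⁺ (n / 2 + 1) , length-upTo (n / 2 + 1) , λ k → mk⇔ (to k) (from k)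
  where
  to : ∀ k → k ∈ upTo (n / 2 + 1) → Achieves n k
  to k k∈ = achieves n k (≤-pred (subst (k <_) (+-comm (n / 2) 1) (∈-upTo⁻ k∈)))
  from : ∀ k → Achieves n k → k ∈ upTo (n / 2 + 1)
  from k (π , pπ , refl , refl) =
    ∈-upTo⁺ (subst (lpk π <_) (+-comm 1 (length π / 2)) (s≤s (lpk-bound π (IsPerm⇒Linked pπ))))

theorem4p10 :
  -- (a) lpk is shuffle-compatible
  (∀ π σ π′ σ′ → IsPerm π → IsPerm σ → IsPerm π′ → IsPerm σ′
    → Disjoint π σ → Disjoint π′ σ′ → π ∼lpk π′ → σ ∼lpk σ′
    → map lpk (shuffles π σ) ↭ map lpk (shuffles π′ σ′))
  ×
  -- (b1) the map [π] ↦ φperm π is multiplicative on basis elements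
  (∀ π σ → IsPerm π → IsPerm σ → Disjoint π σ
    → (φperm π ·ₚ φperm σ) ≋ sumₚ (map φperm (shuffles π σ)))
  ×
  -- (b2) injectivity: images of pairwise distinct lpk-classes are linearly independent
  (∀ (cs : List (List ℕ × ℚ)) → All (λ p → IsPerm (proj₁ p)) cs
    → AllPairs (λ p q → ¬ (proj₁ p ∼lpk proj₁ q)) cs
    → sumₚ (map (λ p → scaleₚ (proj₂ p) (φperm (proj₁ p))) cs) ≋ zeroₚ
    → All (λ p → proj₂ p ≡ 0ℚ) cs)
  ×
  -- (b3) the image of every basis element is one of the spanning elements
  (∀ π → IsPerm π → 1 ≤ length π → lpk π ≤ length π / 2)
  ×
  -- (b4) every spanning element is the image of a basis element
  (Achieves 0 0 × (∀ n j → 1 ≤ n → j ≤ n / 2 → Achieves n j))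
  ×
  -- (c) degree-n component has exactly ⌊n/2⌋ + 1 basis classes
  (∀ n → Σ (List ℕ) (λ L → Unique L × (length L ≡ n / 2 + 1)
                       × (∀ k → (k ∈ L) ⇔ Achieves n k)))
theorem4p10 =
  lpk-shuffle-compatible
  , φperm-multiplicative
  , (λ cs _ → φperm-independent cs)
  , (λ π pπ _ → lpk-bound π (IsPerm⇒Linked pπ))
  , (([] , ([] , []) , refl , refl) , λ n j _ → achieves n j)
  , degree-classes
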